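{- Let $P$ be a bounded and graded poset. Then \[\underline{H}_P(t)=1+t\sum_{x\in P,\ 2\le\rho(x)\le\rho(P)-1}\underline{H}_{[x,\widehat1]}(t)+t\,\underline{H}_{\sigma(P)}(t).\] Alternatively, \[\underline{H}_P(t)=(t+1)\,\underline{H}_{\sigma(P)}(t)-t\,\underline{H}_{\sigma^2(P)}(t)+t\sum_{x\in P,\ \rho(x)=2}\underline{H}_{[x,\widehat1]}(t).\]
   Context: All posets are finite, bounded (least element $\widehat 0$, greatest element $\widehat 1$) and graded with rank function $\rho$, $\rho(\widehat 0)=0$; $\rho(P):=\rho(\widehat1)$. The dual truncation $\sigma(Q)$ of a bounded graded poset $Q$ is $Q$ with all its atoms (elements of rank $1$) removed. $[x,\widehat1]$ denotes an interval of $P$. Chow polynomial: with $\mu$ the Möbius function, $\chi_{[x,y]}(t)=\sum_{x\le z\le y}\mu(x,z)t^{\rho(y)-\rho(z)}$; $\overline{\chi}_{[x,x]}=-1$ and $\overline{\chi}_{[x,y]}=\chi_{[x,y]}/(t-1)$ for $x<y$; $\underline{H}_{[x,x]}=1$ and $\underline{H}_{[x,y]}=\sum_{x<z\le y}\overline{\chi}_{[x,z]}\underline{H}_{[z,y]}$ for $x<y$ (ranks taken in the respective interval/poset); $\underline{H}_Q:=\underline{H}_{[\widehat0,\widehat1]}$ computed in $Q$. -}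

module Defs where

open import Level using (0ℓ)
open import Data.Bool using (Bool; true; false; if_then_else_; _∧_; not)
open import Data.Nat as ℕ using (ℕ; zero; suc; _∸_)
open import Data.Integer as ℤ using (ℤ; 0ℤ; 1ℤ; -1ℤ)
open import Data.List using (List; []; _∷_; map; filterᵇ; length; foldr; replicate; _++_)
open import Data.List.Membership.Propositional using (_∈_)
open import Data.List.Relation.Unary.Unique.Propositional using (Unique)
open import Data.Product using (_×_)
open import Relation.Nullary using (¬_; does)
open import Relation.Binary using (Rel; Decidable; DecidableEquality)
open import Relation.Binary.PropositionalEquality using (_≡_)

-- Polynomials with integer coefficients: coefficient lists, lowest
-- degree first.  Equality is coefficientwise (trailing zeros ignored).

Poly : Set
Poly = List ℤ

coeff : Poly → ℕ → ℤ
coeff []      _       = 0ℤ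
coeff (a ∷ p) zero    = a
coeff (a ∷ p) (suc k) = coeff p k

infix 4 _≈ₚ_
_≈ₚ_ : Poly → Poly → Set
p ≈ₚ q = ∀ k → coeff p k ≡ coeff q k

infixl 6 _+ₚ_
_+ₚ_ : Poly → Poly → Poly
[]      +ₚ q       = q
(a ∷ p) +ₚ []      = a ∷ p
(a ∷ p) +ₚ (b ∷ q) = (a ℤ.+ b) ∷ (p +ₚ q)

scaleₚ : ℤ → Poly → Poly
scaleₚ c = map (c ℤ.*_)

negₚ : Poly → Poly
negₚ = scaleₚ -1ℤ

infixl 7 _*ₚ_
_*ₚ_ : Poly → Poly → Poly
[]      *ₚ q = []
(a ∷ p) *ₚ q = scaleₚ a q +ₚ (0ℤ ∷ (p *ₚ q))

constₚ : ℤ → Poly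
constₚ a = a ∷ []

oneₚ : Poly
oneₚ = constₚ 1ℤ

tₚ : Poly
tₚ = 0ℤ ∷ 1ℤ ∷ []

monomial : ℤ → ℕ → Poly
monomial a n = replicate n 0ℤ ++ (a ∷ [])

sumℤ : List ℤ → ℤ
sumℤ = foldr ℤ._+_ 0ℤ

sumₚ : List Poly → Poly
sumₚ = foldr _+ₚ_ []

sufsum : Poly → Poly
sufsum []      = []
sufsum (a ∷ p) = (a ℤ.+ sumℤ p) ∷ sufsum p

-- quotient of division by (t - 1): q_k = Σ_{j > k} a_j
-- (exact quotient whenever p(1) = 0)
divByTMinus1 : Poly → Poly
divByTMinus1 []      = []
divByTMinus1 (a ∷ p) = sufsum p

record PosetData : Set₁ where
  field
    Carrier : Set
    _≟_     : DecidableEquality Carrier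
    _≤_     : Rel Carrier 0ℓ
    _≤?_    : Decidable _≤_
    elems   : List Carrier
    bot     : Carrier
    top     : Carrier
    rank    : Carrier → ℕ

record IsBoundedGraded (P : PosetData) : Set where
  open PosetData P
  _<_ : Carrier → Carrier → Set
  x < y = x ≤ y × ¬ (x ≡ y)
  _⋖_ : Carrier → Carrier → Set
  x ⋖ y = x < y × (∀ z → ¬ (x < z × z < y))
  field
    complete : ∀ x → x ∈ elems
    unique   : Unique elems
    refl≤    : ∀ x → x ≤ x
    antisym  : ∀ {x y} → x ≤ y → y ≤ x → x ≡ y
    trans≤   : ∀ {x y z} → x ≤ y → y ≤ z → x ≤ z
    bot≤     : ∀ x → bot ≤ x
    ≤top     : ∀ x → x ≤ top
    rank-bot : rank bot ≡ 0
    rank-cov : ∀ {x y} → x ⋖ y → rank y ≡ suc (rank x)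

module _ (P : PosetData) where
  open PosetData P

  _≤ᵇ_ : Carrier → Carrier → Bool
  x ≤ᵇ y = does (x ≤? y)

  _≡ᵇ_ : Carrier → Carrier → Bool
  x ≡ᵇ y = does (x ≟ y)

  _<ᵇ_ : Carrier → Carrier → Bool
  x <ᵇ y = (x ≤ᵇ y) ∧ not (x ≡ᵇ y)

  -- Möbius function with fuel: μ(x,x)=1, μ(x,y) = -Σ_{x≤z<y} μ(x,z)
  -- for x<y, 0 otherwise.  Fuel = number of elements suffices.
  mobiusFuel : ℕ → Carrier → Carrier → ℤ
  mobiusFuel zero    x y = 0ℤ
  mobiusFuel (suc n) x y =
    if x ≡ᵇ y then 1ℤ
    else if x ≤ᵇ y
      then ℤ.- sumℤ (map (mobiusFuel n x) (filterᵇ (λ z → (x ≤ᵇ z) ∧ (z <ᵇ y)) elems))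
      else 0ℤ

  mobius : Carrier → Carrier → ℤ
  mobius = mobiusFuel (length elems)

  charPoly : Carrier → Carrier → Poly
  charPoly x y = sumₚ (map (λ z → monomial (mobius x z) (rank y ∸ rank z))
                           (filterᵇ (λ z → (x ≤ᵇ z) ∧ (z ≤ᵇ y)) elems))

  redCharPoly : Carrier → Carrier → Poly
  redCharPoly x y = if x ≡ᵇ y then constₚ -1ℤ else divByTMinus1 (charPoly x y)

  chowFuel : ℕ → Carrier → Carrier → Poly
  chowFuel zero    x y = []
  chowFuel (suc n) x y =
    if x ≡ᵇ y then oneₚ
    else sumₚ (map (λ z → redCharPoly x z *ₚ chowFuel n z y)
                   (filterᵇ (λ z → (x <ᵇ z) ∧ (z ≤ᵇ y)) elems))

  chowInterval : Carrier → Carrier → Poly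
  chowInterval = chowFuel (length elems)

chow : PosetData → Poly
chow P = chowInterval P (PosetData.bot P) (PosetData.top P)

rankP : PosetData → ℕ
rankP P = PosetData.rank P (PosetData.top P)

-- Dual truncation σ(Q): remove all elements of rank 1.  Ranks drop by
-- one (bottom stays 0).  If the top itself has rank 1, it is removed and
-- the result is the one-element poset {0̂}.

σ : PosetData → PosetData
σ P = record
  { Carrier = Carrier
  ; _≟_     = _≟_
  ; _≤_     = _≤_
  ; _≤?_    = _≤?_
  ; elems   = filterᵇ (λ x → not (does (rank x ℕ.≟ 1))) elems
  ; bot     = bot
  ; top     = if does (rank top ℕ.≟ 1) then bot else top
  ; rank    = λ x → rank x ∸ 1
  }
  where open PosetData P

sumMid : PosetData → Poly
sumMid P = sumₚ (map (λ x → chowInterval P x top)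
                     (filterᵇ (λ x → (2 ℕ.≤ᵇ rank x) ∧ (rank x ℕ.≤ᵇ (rank top ∸ 1))) elems))
  where open PosetData P

sumRank2 : PosetData → Poly
sumRank2 P = sumₚ (map (λ x → chowInterval P x top)
                       (filterᵇ (λ x → does (rank x ℕ.≟ 2)) elems))
  where open PosetData P

-- Write H_x for H_[x,1̂] and [d]ₜ = 1 + t + ⋯ + t^(d-1). Expanding the recursion for H_x with
-- χ̄_[x,z] = Σ_{x≤w≤z} μ(x,w) [ρz − ρw]ₜ and inverting with the Möbius function gives, for every x,
--   Σ_{z ≥ x} H_z = 1 + Σ_{z > x} [ρz − ρx]ₜ H_z.
-- At x = 0̂, since [r]ₜ = 1 + t [r − 1]ₜ, this says H_P = 1 + t Σ_{ρz ≥ 2} [ρz − 1]ₜ H_z. For ρz ≥ 2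
-- the intervals [z,1̂] of P and of σ(P) coincide, so comparing this formula for P and for σ(P) gives
--   H_P + t = 1 + t Σ_{ρz ≥ 2} H_z + t H_σ(P).
-- Splitting off z = 1̂ yields the first identity; splitting off ρz = 2 and using the same relation
-- for σ(P) yields the second.

module Submission where

open import Level using (0ℓ)
open import Data.Bool using (Bool; true; false; if_then_else_; _∧_; _∨_; not; T)
open import Data.Bool.Properties using (T-≡; ∧-conicalˡ; ∧-conicalʳ; ∧-identityʳ; ∧-zeroʳ; ∨-identityʳ; ∨-zeroʳ)
open import Data.Nat as ℕ using (ℕ; zero; suc; _∸_; z≤n; s≤s)
import Data.Nat.Properties as ℕP
open import Data.Integer as ℤ using (ℤ; 0ℤ; 1ℤ; -1ℤ)
import Data.Integer.Properties as ℤP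
open import Data.List using (List; []; _∷_; map; foldr; filterᵇ; length; replicate)
open import Data.List.Properties using (filter-notAll)
open import Data.List.Membership.Propositional using (_∈_; lose)
open import Data.List.Membership.Propositional.Properties using (∈-filter⁺; ∈-filter⁻)
open import Data.List.Relation.Unary.Any using (here; there)
open import Data.List.Relation.Unary.All using (lookup)
open import Data.List.Relation.Unary.Unique.Propositional using (Unique; _∷_)
open import Data.List.Relation.Unary.Unique.Propositional.Properties as Unique using ()
import Data.Maybe as Maybe
open import Data.Product using (_×_; _,_; proj₁; proj₂; map₂)
open import Function using (_∘_; case_of_)
open import Function.Bundles using (Equivalence)
open import Relation.Binary using (DecidableEquality)
open import Relation.Binary.PropositionalEquality using (_≡_; _≢_; refl; sym; trans; cong; cong₂; subst; subst₂)
open import Relation.Nullary using (¬_; does; yes; no; contradiction)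
open import Relation.Nullary.Decidable using (T?; dec-true; dec-false; dec⇒maybe)
open import Algebra.Bundles using (RawRing; Semiring; CommutativeRing)
open import Algebra.Properties.CommutativeSemigroup as CommSemigroupProperties using ()
open import Algebra.Solver.Ring.AlmostCommutativeRing using (_-Raw-AlmostCommutative⟶_; fromCommutativeRing)
open import Defs hiding (_≤ᵇ_; _<ᵇ_; _≡ᵇ_)
import Defs

private variable X Y : Set

module ℤ+ = CommSemigroupProperties ℤP.+-commutativeSemigroup

-- Integer polynomials as a commutative ring

coeff-+ : ∀ p q k → coeff (p +ₚ q) k ≡ coeff p k ℤ.+ coeff q k
coeff-+ []      q       k       = sym (ℤP.+-identityˡ _)
coeff-+ (a ∷ p) []      k       = sym (ℤP.+-identityʳ _)
coeff-+ (a ∷ p) (b ∷ q) zero    = refl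
coeff-+ (a ∷ p) (b ∷ q) (suc k) = coeff-+ p q k

coeff-scale : ∀ c p k → coeff (scaleₚ c p) k ≡ c ℤ.* coeff p k
coeff-scale c []      k       = sym (ℤP.*-zeroʳ c)
coeff-scale c (a ∷ p) zero    = refl
coeff-scale c (a ∷ p) (suc k) = coeff-scale c p k

-- A record around _≈ₚ_ so that both polynomials can be inferred from an equation.
infix 4 _≋_
record _≋_ (p q : Poly) : Set where
  constructor coeffwise
  field coeff-≡ : p ≈ₚ q
open _≋_ public

≋-refl : ∀ {p} → p ≋ p
≋-refl = coeffwise λ _ → refl

≋-reflexive : ∀ {p q} → p ≡ q → p ≋ q
≋-reflexive refl = ≋-refl

≋-sym : ∀ {p q} → p ≋ q → q ≋ p
≋-sym (coeffwise e) = coeffwise λ k → sym (e k)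

≋-trans : ∀ {p q r} → p ≋ q → q ≋ r → p ≋ r
≋-trans (coeffwise e) (coeffwise f) = coeffwise λ k → trans (e k) (f k)

∷-cong : ∀ {a b p q} → a ≡ b → p ≋ q → a ∷ p ≋ b ∷ q
∷-cong a≡b (coeffwise e) = coeffwise λ { zero → a≡b ; (suc k) → e k }

+ₚ-cong : ∀ {p p′ q q′} → p ≋ p′ → q ≋ q′ → p +ₚ q ≋ p′ +ₚ q′
+ₚ-cong {p} {p′} {q} {q′} (coeffwise e) (coeffwise f) = coeffwise λ k →
  trans (coeff-+ p q k) (trans (cong₂ ℤ._+_ (e k) (f k)) (sym (coeff-+ p′ q′ k)))

+ₚ-assoc : ∀ p q r → (p +ₚ q) +ₚ r ≋ p +ₚ (q +ₚ r)
+ₚ-assoc p q r = coeffwise λ k →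
  trans (coeff-+ (p +ₚ q) r k) (trans (cong (ℤ._+ coeff r k) (coeff-+ p q k))
  (trans (ℤP.+-assoc (coeff p k) (coeff q k) (coeff r k))
  (trans (cong (λ v → coeff p k ℤ.+ v) (sym (coeff-+ q r k))) (sym (coeff-+ p (q +ₚ r) k)))))

+ₚ-comm : ∀ p q → p +ₚ q ≋ q +ₚ p
+ₚ-comm p q = coeffwise λ k →
  trans (coeff-+ p q k) (trans (ℤP.+-comm (coeff p k) (coeff q k)) (sym (coeff-+ q p k)))

+ₚ-identityʳ : ∀ p → p +ₚ [] ≋ p
+ₚ-identityʳ p = coeffwise λ k → trans (coeff-+ p [] k) (ℤP.+-identityʳ _)

scaleₚ-cong : ∀ c {p q} → p ≋ q → scaleₚ c p ≋ scaleₚ c q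
scaleₚ-cong c {p} {q} (coeffwise e) = coeffwise λ k →
  trans (coeff-scale c p k) (trans (cong (c ℤ.*_) (e k)) (sym (coeff-scale c q k)))

scaleₚ-distribˡ : ∀ c p q → scaleₚ c (p +ₚ q) ≋ scaleₚ c p +ₚ scaleₚ c q
scaleₚ-distribˡ c p q = coeffwise λ k →
  trans (coeff-scale c (p +ₚ q) k) (trans (cong (c ℤ.*_) (coeff-+ p q k))
  (trans (ℤP.*-distribˡ-+ c (coeff p k) (coeff q k))
  (sym (trans (coeff-+ (scaleₚ c p) (scaleₚ c q) k) (cong₂ ℤ._+_ (coeff-scale c p k) (coeff-scale c q k))))))

scaleₚ-assoc : ∀ a b p → scaleₚ (a ℤ.* b) p ≋ scaleₚ a (scaleₚ b p)
scaleₚ-assoc a b p = coeffwise λ k →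
  trans (coeff-scale (a ℤ.* b) p k) (trans (ℤP.*-assoc a b (coeff p k))
  (trans (cong (a ℤ.*_) (sym (coeff-scale b p k))) (sym (coeff-scale a (scaleₚ b p) k))))

scaleₚ-zero : ∀ p → scaleₚ 0ℤ p ≋ []
scaleₚ-zero p = coeffwise (coeff-scale 0ℤ p)

scaleₚ-identity : ∀ p → scaleₚ 1ℤ p ≋ p
scaleₚ-identity p = coeffwise λ k → trans (coeff-scale 1ℤ p k) (ℤP.*-identityˡ _)

negₚ-inverseʳ : ∀ p → p +ₚ negₚ p ≋ []
negₚ-inverseʳ p = coeffwise λ k →
  trans (coeff-+ p (negₚ p) k) (trans (cong (λ v → coeff p k ℤ.+ v) (trans (coeff-scale -1ℤ p k) (ℤP.-1*i≡-i (coeff p k))))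
  (ℤP.+-inverseʳ (coeff p k)))

+ₚ-interchange : ∀ a b c d → (a +ₚ b) +ₚ (c +ₚ d) ≋ (a +ₚ c) +ₚ (b +ₚ d)
+ₚ-interchange a b c d = coeffwise λ k →
  trans (coeff-+ (a +ₚ b) (c +ₚ d) k) (trans (cong₂ ℤ._+_ (coeff-+ a b k) (coeff-+ c d k))
  (trans (ℤ+.interchange (coeff a k) (coeff b k) (coeff c k) (coeff d k))
  (sym (trans (coeff-+ (a +ₚ c) (b +ₚ d) k) (cong₂ ℤ._+_ (coeff-+ a c k) (coeff-+ b d k))))))

*ₚ-congʳ : ∀ p {q q′} → q ≋ q′ → p *ₚ q ≋ p *ₚ q′
*ₚ-congʳ []      e = ≋-refl
*ₚ-congʳ (a ∷ p) e = +ₚ-cong (scaleₚ-cong a e) (∷-cong refl (*ₚ-congʳ p e))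

*ₚ-distribˡ : ∀ r p q → r *ₚ (p +ₚ q) ≋ r *ₚ p +ₚ r *ₚ q
*ₚ-distribˡ []      p q = ≋-refl
*ₚ-distribˡ (a ∷ r) p q = ≋-trans (+ₚ-cong (scaleₚ-distribˡ a p q) (∷-cong refl (*ₚ-distribˡ r p q)))
  (+ₚ-interchange (scaleₚ a p) (scaleₚ a q) (0ℤ ∷ r *ₚ p) (0ℤ ∷ r *ₚ q))

*ₚ-zeroʳ : ∀ p → p *ₚ [] ≋ []
*ₚ-zeroʳ []      = ≋-refl
*ₚ-zeroʳ (a ∷ p) = coeffwise λ { zero → refl ; (suc k) → coeff-≡ (*ₚ-zeroʳ p) k }

*ₚ-constʳ : ∀ p a → p *ₚ constₚ a ≋ scaleₚ a p
*ₚ-constʳ []      a = ≋-refl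
*ₚ-constʳ (b ∷ p) a = ∷-cong (trans (ℤP.+-identityʳ _) (ℤP.*-comm b a)) (*ₚ-constʳ p a)

*ₚ-shiftʳ : ∀ p q → p *ₚ (0ℤ ∷ q) ≋ 0ℤ ∷ p *ₚ q
*ₚ-shiftʳ []      q = coeffwise λ { zero → refl ; (suc k) → refl }
*ₚ-shiftʳ (b ∷ p) q = ∷-cong (trans (ℤP.+-identityʳ _) (ℤP.*-zeroʳ b))
  (+ₚ-cong (≋-refl {scaleₚ b q}) (*ₚ-shiftʳ p q))

∷-split : ∀ a p → a ∷ p ≋ constₚ a +ₚ (0ℤ ∷ p)
∷-split a p = ∷-cong (sym (ℤP.+-identityʳ a)) ≋-refl

*ₚ-comm : ∀ p q → p *ₚ q ≋ q *ₚ p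
*ₚ-comm []      q = ≋-sym (*ₚ-zeroʳ q)
*ₚ-comm (a ∷ p) q = ≋-sym (≋-trans (*ₚ-congʳ q (∷-split a p)) (≋-trans (*ₚ-distribˡ q (constₚ a) (0ℤ ∷ p))
  (+ₚ-cong (*ₚ-constʳ q a) (≋-trans (*ₚ-shiftʳ q p) (∷-cong refl (*ₚ-comm q p))))))

*ₚ-cong : ∀ {p p′ q q′} → p ≋ p′ → q ≋ q′ → p *ₚ q ≋ p′ *ₚ q′
*ₚ-cong {p} {p′} {q} {q′} e f =
  ≋-trans (*ₚ-comm p q) (≋-trans (*ₚ-congʳ q e) (≋-trans (*ₚ-comm q p′) (*ₚ-congʳ p′ f)))

*ₚ-distribʳ : ∀ r p q → (p +ₚ q) *ₚ r ≋ p *ₚ r +ₚ q *ₚ r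
*ₚ-distribʳ r p q = ≋-trans (*ₚ-comm (p +ₚ q) r)
  (≋-trans (*ₚ-distribˡ r p q) (+ₚ-cong (*ₚ-comm r p) (*ₚ-comm r q)))

scaleₚ-*ₚ : ∀ a p q → scaleₚ a p *ₚ q ≋ scaleₚ a (p *ₚ q)
scaleₚ-*ₚ a []      q = ≋-refl
scaleₚ-*ₚ a (b ∷ p) q = ≋-trans (+ₚ-cong (scaleₚ-assoc a b q) (∷-cong (sym (ℤP.*-zeroʳ a)) (scaleₚ-*ₚ a p q)))
  (≋-sym (scaleₚ-distribˡ a (scaleₚ b q) (0ℤ ∷ p *ₚ q)))

*ₚ-assoc : ∀ p q r → (p *ₚ q) *ₚ r ≋ p *ₚ (q *ₚ r)
*ₚ-assoc []      q r = ≋-refl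
*ₚ-assoc (a ∷ p) q r = ≋-trans (*ₚ-distribʳ r (scaleₚ a q) (0ℤ ∷ p *ₚ q))
  (+ₚ-cong (scaleₚ-*ₚ a q r) (≋-trans (+ₚ-cong (scaleₚ-zero r) ≋-refl) (∷-cong refl (*ₚ-assoc p q r))))

constₚ-*ₚ : ∀ a p → constₚ a *ₚ p ≋ scaleₚ a p
constₚ-*ₚ a p = ≋-trans (+ₚ-cong (≋-refl {scaleₚ a p}) (coeffwise {q = []} λ { zero → refl ; (suc k) → refl }))
                       (+ₚ-identityʳ _)

*ₚ-identityˡ : ∀ p → oneₚ *ₚ p ≋ p
*ₚ-identityˡ p = ≋-trans (constₚ-*ₚ 1ℤ p) (scaleₚ-identity p)

Poly-commutativeRing : CommutativeRing 0ℓ 0ℓ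
Poly-commutativeRing = record
  { Carrier = Poly ; _≈_ = _≋_ ; _+_ = _+ₚ_ ; _*_ = _*ₚ_ ; -_ = negₚ ; 0# = [] ; 1# = oneₚ
  ; isCommutativeRing = record
    { isRing = record
      { +-isAbelianGroup = record
        { isGroup = record
          { isMonoid = record
            { isSemigroup = record
              { isMagma = record
                { isEquivalence = record { refl = ≋-refl ; sym = ≋-sym ; trans = ≋-trans }
                ; ∙-cong = +ₚ-cong }
              ; assoc = +ₚ-assoc }
            ; identity = (λ _ → ≋-refl) , +ₚ-identityʳ }
          ; inverse = (λ p → ≋-trans (+ₚ-comm (negₚ p) p) (negₚ-inverseʳ p)) , negₚ-inverseʳ
          ; ⁻¹-cong = scaleₚ-cong -1ℤ }
        ; comm = +ₚ-comm }
      ; *-cong = *ₚ-cong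
      ; *-assoc = *ₚ-assoc
      ; *-identity = *ₚ-identityˡ , (λ p → ≋-trans (*ₚ-comm p oneₚ) (*ₚ-identityˡ p))
      ; distrib = *ₚ-distribˡ , *ₚ-distribʳ }
    ; *-comm = *ₚ-comm } }

-- Finite sums

module ListSum {c ℓ} (R : Semiring c ℓ) where
  open Semiring R renaming (refl to ≈-refl; sym to ≈-sym; trans to ≈-trans; reflexive to ≈-reflexive)
  open import Algebra.Properties.CommutativeSemigroup +-commutativeSemigroup using (interchange)

  ∑ : List X → (X → Carrier) → Carrier
  ∑ l f = foldr _+_ 0# (map f l)

  infix 5 ∑
  syntax ∑ l (λ x → e) = ∑[ x ∈ l ] e

  ⟦_⟧ : Bool → Carrier
  ⟦ true  ⟧ = 1#
  ⟦ false ⟧ = 0#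

  ⟦∧⟧ : ∀ a b → ⟦ a ∧ b ⟧ ≈ ⟦ a ⟧ * ⟦ b ⟧
  ⟦∧⟧ true  b = ≈-sym (*-identityˡ ⟦ b ⟧)
  ⟦∧⟧ false b = ≈-sym (zeroˡ ⟦ b ⟧)

  ⟦∨⟧ : ∀ a b → a ∧ b ≡ false → ⟦ a ∨ b ⟧ ≈ ⟦ a ⟧ + ⟦ b ⟧
  ⟦∨⟧ true  false _ = ≈-sym (+-identityʳ 1#)
  ⟦∨⟧ false b     _ = ≈-sym (+-identityˡ ⟦ b ⟧)

  ∑-cong : ∀ (l : List X) {f g : X → Carrier} → (∀ {x} → x ∈ l → f x ≈ g x) → ∑ l f ≈ ∑ l g
  ∑-cong []      f≈g = ≈-refl
  ∑-cong (x ∷ l) f≈g = +-cong (f≈g (here refl)) (∑-cong l (λ x∈l → f≈g (there x∈l)))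

  ∑-zero : ∀ (l : List X) {f : X → Carrier} → (∀ {x} → x ∈ l → f x ≈ 0#) → ∑ l f ≈ 0#
  ∑-zero []      f≈0 = ≈-refl
  ∑-zero (x ∷ l) f≈0 = ≈-trans (+-cong (f≈0 (here refl)) (∑-zero l (λ x∈l → f≈0 (there x∈l)))) (+-identityˡ 0#)

  ∑-+ : ∀ (l : List X) (f g : X → Carrier) → ∑[ x ∈ l ] (f x + g x) ≈ ∑ l f + ∑ l g
  ∑-+ []      f g = ≈-sym (+-identityˡ 0#)
  ∑-+ (x ∷ l) f g = ≈-trans (+-congˡ (∑-+ l f g)) (interchange (f x) (g x) (∑ l f) (∑ l g))

  *-∑ : ∀ a (l : List X) (f : X → Carrier) → a * ∑ l f ≈ ∑[ x ∈ l ] (a * f x)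
  *-∑ a []      f = zeroʳ a
  *-∑ a (x ∷ l) f = ≈-trans (distribˡ a (f x) (∑ l f)) (+-congˡ (*-∑ a l f))

  ∑-* : ∀ a (l : List X) (f : X → Carrier) → ∑ l f * a ≈ ∑[ x ∈ l ] (f x * a)
  ∑-* a []      f = zeroˡ a
  ∑-* a (x ∷ l) f = ≈-trans (distribʳ a (f x) (∑ l f)) (+-congˡ (∑-* a l f))

  ∑-swap : ∀ (l : List X) (m : List Y) (g : X → Y → Carrier) →
           ∑[ x ∈ l ] ∑[ y ∈ m ] g x y ≈ ∑[ y ∈ m ] ∑[ x ∈ l ] g x y
  ∑-swap []      m g = ≈-sym (∑-zero m (λ _ → ≈-refl))
  ∑-swap (x ∷ l) m g = ≈-trans (+-congˡ (∑-swap l m g)) (≈-sym (∑-+ m (g x) (λ y → ∑[ x′ ∈ l ] g x′ y)))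

  ∑-filterᵇ : ∀ (p : X → Bool) (l : List X) (f : X → Carrier) →
              ∑ (filterᵇ p l) f ≈ ∑[ x ∈ l ] (⟦ p x ⟧ * f x)
  ∑-filterᵇ p []      f = ≈-refl
  ∑-filterᵇ p (x ∷ l) f with p x
  ... | true  = +-cong (≈-sym (*-identityˡ (f x))) (∑-filterᵇ p l f)
  ... | false = ≈-trans (∑-filterᵇ p l f) (≈-sym (≈-trans (+-congʳ (zeroˡ (f x))) (+-identityˡ _)))

  ∑-δ : ∀ (_≟_ : DecidableEquality X) {x l} (f : X → Carrier) → Unique l → x ∈ l →
        ∑[ y ∈ l ] (⟦ does (x ≟ y) ⟧ * f y) ≈ f x
  ∑-δ _≟_ {x} f (x∉l ∷ _) (here refl) rewrite dec-true (x ≟ x) refl =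
    ≈-trans (+-cong (*-identityˡ (f x)) (∑-zero _ λ {y} y∈l →
            ≈-trans (*-congʳ (≈-reflexive (cong ⟦_⟧ (dec-false (x ≟ y) (lookup x∉l y∈l))))) (zeroˡ (f y))))
          (+-identityʳ (f x))
  ∑-δ _≟_ {x} f (_∷_ {y} y∉l u) (there x∈l) with x ≟ y
  ... | yes refl = contradiction refl (lookup y∉l x∈l)
  ... | no _     = ≈-trans (+-congʳ (zeroˡ (f y))) (≈-trans (+-identityˡ _) (∑-δ _≟_ f u x∈l))

open CommutativeRing Poly-commutativeRing using (semiring; setoid; -‿inverseˡ; -‿inverseʳ)
open ListSum semiring
open import Relation.Binary.Reasoning.Setoid setoid

ℤ-rawRing : RawRing 0ℓ 0ℓ
ℤ-rawRing = CommutativeRing.rawRing ℤP.+-*-commutativeRing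

[_]ₜ : ℕ → Poly
[ d ]ₜ = replicate d 1ℤ

tₚ*ₚ : ∀ p → tₚ *ₚ p ≋ 0ℤ ∷ p
tₚ*ₚ p = ≋-trans (+ₚ-cong (scaleₚ-zero p) (∷-cong refl (*ₚ-identityˡ p))) ≋-refl

[suc]ₜ : ∀ d → [ suc d ]ₜ ≋ oneₚ +ₚ tₚ *ₚ [ d ]ₜ
[suc]ₜ d = ≋-sym (≋-trans (+ₚ-cong (≋-refl {oneₚ}) (tₚ*ₚ [ d ]ₜ)) ≋-refl)

constₚ-neg : ∀ a → constₚ (ℤ.- a) ≋ negₚ (constₚ a)
constₚ-neg a = ∷-cong (sym (ℤP.-1*i≡-i a)) ≋-refl

-- Ring identities in Poly are decided by normalisation with integer coefficients.
constₚ-homomorphism : ℤ-rawRing -Raw-AlmostCommutative⟶ fromCommutativeRing Poly-commutativeRing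
constₚ-homomorphism = record
  { ⟦_⟧    = constₚ
  ; +-homo = λ _ _ → ≋-refl
  ; *-homo = λ a b → ∷-cong (sym (ℤP.+-identityʳ (a ℤ.* b))) ≋-refl
  ; -‿homo = constₚ-neg
  ; 0-homo = coeffwise λ { zero → refl ; (suc k) → refl }
  ; 1-homo = ≋-refl
  }

open import Algebra.Solver.Ring ℤ-rawRing (fromCommutativeRing Poly-commutativeRing) constₚ-homomorphism
  (λ a b → Maybe.map (≋-reflexive ∘ cong constₚ) (dec⇒maybe (a ℤ.≟ b)))
  using (solve; _:=_; _:+_; _:*_; :-_; _:-_; con)

sumℤ-+ₚ : ∀ p q → sumℤ (p +ₚ q) ≡ sumℤ p ℤ.+ sumℤ q
sumℤ-+ₚ []      q       = sym (ℤP.+-identityˡ _)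
sumℤ-+ₚ (a ∷ p) []      = sym (ℤP.+-identityʳ _)
sumℤ-+ₚ (a ∷ p) (b ∷ q) = trans (cong (λ s → (a ℤ.+ b) ℤ.+ s) (sumℤ-+ₚ p q)) (ℤ+.interchange a b (sumℤ p) (sumℤ q))

sufsum-+ₚ : ∀ p q → sufsum (p +ₚ q) ≋ sufsum p +ₚ sufsum q
sufsum-+ₚ []      q       = ≋-refl
sufsum-+ₚ (a ∷ p) []      = ≋-sym (+ₚ-identityʳ _)
sufsum-+ₚ (a ∷ p) (b ∷ q) = ∷-cong (sumℤ-+ₚ (a ∷ p) (b ∷ q)) (sufsum-+ₚ p q)

divByTMinus1-+ₚ : ∀ p q → divByTMinus1 (p +ₚ q) ≋ divByTMinus1 p +ₚ divByTMinus1 q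
divByTMinus1-+ₚ []      q       = ≋-refl
divByTMinus1-+ₚ (a ∷ p) []      = ≋-sym (+ₚ-identityʳ _)
divByTMinus1-+ₚ (a ∷ p) (b ∷ q) = sufsum-+ₚ p q

divByTMinus1-∑ : ∀ (l : List X) (f : X → Poly) → divByTMinus1 (∑ l f) ≋ (∑[ x ∈ l ] divByTMinus1 (f x))
divByTMinus1-∑ []      f = ≋-refl
divByTMinus1-∑ (x ∷ l) f = ≋-trans (divByTMinus1-+ₚ (f x) (∑ l f)) (+ₚ-cong ≋-refl (divByTMinus1-∑ l f))

sumℤ-monomial : ∀ a d → sumℤ (monomial a d) ≡ a
sumℤ-monomial a zero    = ℤP.+-identityʳ a
sumℤ-monomial a (suc d) = trans (ℤP.+-identityˡ _) (sumℤ-monomial a d)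

sufsum-monomial : ∀ a d → sufsum (monomial a d) ≋ replicate (suc d) a
sufsum-monomial a zero    = ∷-cong (ℤP.+-identityʳ a) ≋-refl
sufsum-monomial a (suc d) = ∷-cong (trans (ℤP.+-identityˡ _) (sumℤ-monomial a d)) (sufsum-monomial a d)

constₚ-*ₚ-[]ₜ : ∀ a n → constₚ a *ₚ [ n ]ₜ ≋ replicate n a
constₚ-*ₚ-[]ₜ a n = ≋-trans (constₚ-*ₚ a [ n ]ₜ) (scale-replicate n)
  where
  scale-replicate : ∀ n → scaleₚ a [ n ]ₜ ≋ replicate n a
  scale-replicate zero    = ≋-refl
  scale-replicate (suc n) = ∷-cong (ℤP.*-identityʳ a) (scale-replicate n)

divByTMinus1-monomial : ∀ a d → divByTMinus1 (monomial a d) ≋ constₚ a *ₚ [ d ]ₜ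
divByTMinus1-monomial a zero    = ≋-sym (constₚ-*ₚ-[]ₜ a 0)
divByTMinus1-monomial a (suc d) = ≋-trans (sufsum-monomial a d) (≋-sym (constₚ-*ₚ-[]ₜ a (suc d)))

constₚ-sumℤ : ∀ (f : X → ℤ) l → constₚ (sumℤ (map f l)) ≋ ∑[ x ∈ l ] constₚ (f x)
constₚ-sumℤ f []      = coeffwise λ { zero → refl ; (suc k) → refl }
constₚ-sumℤ f (x ∷ l) = +ₚ-cong (≋-refl {constₚ (f x)}) (constₚ-sumℤ f l)

∑-negₚ : ∀ (l : List X) (f : X → Poly) → (∑[ x ∈ l ] negₚ (f x)) ≋ negₚ (∑ l f)
∑-negₚ []      f = ≋-refl
∑-negₚ (x ∷ l) f = ≋-trans (+ₚ-cong ≋-refl (∑-negₚ l f)) (≋-sym (scaleₚ-distribˡ -1ℤ (f x) (∑ l f)))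

[]ₜ-peel : ∀ m r h → ⟦ suc m ℕ.≤ᵇ r ⟧ *ₚ ([ r ∸ m ]ₜ *ₚ h) ≋
                     ⟦ suc m ℕ.≤ᵇ r ⟧ *ₚ h +ₚ tₚ *ₚ (⟦ suc (suc m) ℕ.≤ᵇ r ⟧ *ₚ ([ r ∸ suc m ]ₜ *ₚ h))
[]ₜ-peel zero    zero          h = ≋-sym (*ₚ-zeroʳ tₚ)
[]ₜ-peel zero    (suc zero)    h = ≋-trans (*ₚ-congʳ oneₚ (*ₚ-identityˡ h))
                                           (≋-sym (≋-trans (+ₚ-cong ≋-refl (*ₚ-zeroʳ tₚ)) (+ₚ-identityʳ _)))
[]ₜ-peel zero    (suc (suc r)) h = begin
  oneₚ *ₚ ([ suc (suc r) ]ₜ *ₚ h)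
    ≈⟨ *ₚ-congʳ oneₚ (*ₚ-cong ([suc]ₜ (suc r)) ≋-refl) ⟩
  oneₚ *ₚ ((oneₚ +ₚ tₚ *ₚ [ suc r ]ₜ) *ₚ h)
    ≈⟨ solve 3 (λ t d h → con 1ℤ :* ((con 1ℤ :+ t :* d) :* h) := con 1ℤ :* h :+ t :* (con 1ℤ :* (d :* h)))
               ≋-refl tₚ [ suc r ]ₜ h ⟩
  oneₚ *ₚ h +ₚ tₚ *ₚ (oneₚ *ₚ ([ suc r ]ₜ *ₚ h)) ∎
[]ₜ-peel (suc m) zero          h = ≋-sym (*ₚ-zeroʳ tₚ)
[]ₜ-peel (suc m) (suc r)       h = []ₜ-peel m r h

-- Posets presented by an element list

ℕ≤ᵇ-true : ∀ {m n} → m ℕ.≤ n → (m ℕ.≤ᵇ n) ≡ true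
ℕ≤ᵇ-true {m} {n} = dec-true (m ℕ.≤? n)

ℕ≤ᵇ-false : ∀ {m n} → ¬ m ℕ.≤ n → (m ℕ.≤ᵇ n) ≡ false
ℕ≤ᵇ-false {m} {n} = dec-false (m ℕ.≤? n)

ℕ≤ᵇ-sound : ∀ {m n} → (m ℕ.≤ᵇ n) ≡ true → m ℕ.≤ n
ℕ≤ᵇ-sound {m} {n} e = ℕP.≤ᵇ⇒≤ m n (Equivalence.from T-≡ e)

∧-true⁻ : ∀ {a b} → a ∧ b ≡ true → a ≡ true × b ≡ true
∧-true⁻ {a} {b} e = ∧-conicalˡ a b e , ∧-conicalʳ a b e

map-cong-∈ : ∀ {B : Set} {f g : X → B} (l : List X) → (∀ {x} → x ∈ l → f x ≡ g x) → map f l ≡ map g l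
map-cong-∈ []      f≡g = refl
map-cong-∈ (x ∷ l) f≡g = cong₂ _∷_ (f≡g (here refl)) (map-cong-∈ l (f≡g ∘ there))

∈-filterᵇ⁻ : ∀ (p : X → Bool) {x} l → x ∈ filterᵇ p l → x ∈ l × p x ≡ true
∈-filterᵇ⁻ p l = map₂ (Equivalence.to T-≡) ∘ ∈-filter⁻ (T? ∘ p)

∈-filterᵇ⁺ : ∀ (p : X → Bool) {x} l → x ∈ l → p x ≡ true → x ∈ filterᵇ p l
∈-filterᵇ⁺ p l x∈l px = ∈-filter⁺ (T? ∘ p) x∈l (Equivalence.from T-≡ px)

filterᵇ-absorb : ∀ (p q : X → Bool) l → (∀ {x} → x ∈ l → p x ≡ true → q x ≡ true) →
                 filterᵇ p (filterᵇ q l) ≡ filterᵇ p l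
filterᵇ-absorb p q []      p⇒q = refl
filterᵇ-absorb p q (x ∷ l) p⇒q with q x in qx | p x in px
... | true  | true  rewrite px = cong (x ∷_) (filterᵇ-absorb p q l (p⇒q ∘ there))
... | true  | false rewrite px = filterᵇ-absorb p q l (p⇒q ∘ there)
... | false | true  = contradiction (trans (sym (p⇒q (here refl) px)) qx) λ ()
... | false | false = filterᵇ-absorb p q l (p⇒q ∘ there)

length-filterᵇ-reject : ∀ (p : X → Bool) {x} l → x ∈ l → p x ≡ false → length (filterᵇ p l) ℕ.< length l
length-filterᵇ-reject p l x∈l px = filter-notAll (T? ∘ p) l (lose x∈l (λ t → subst T px t))

length-filterᵇ-< : ∀ (p q : X → Bool) {x} l → (∀ {y} → y ∈ l → p y ≡ true → q y ≡ true) →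
                   x ∈ l → q x ≡ true → p x ≡ false → length (filterᵇ p l) ℕ.< length (filterᵇ q l)
length-filterᵇ-< p q l p⇒q x∈l qx px rewrite sym (filterᵇ-absorb p q l p⇒q) =
  length-filterᵇ-reject p (filterᵇ q l) (∈-filterᵇ⁺ q l x∈l qx) px

module Order (Q : PosetData) where
  open PosetData Q

  infix 4 _<_
  infix 5 _≤ᵇ_ _<ᵇ_ _≡ᵇ_
  _<_ : Carrier → Carrier → Set
  x < y = x ≤ y × x ≢ y

  _≤ᵇ_ _<ᵇ_ _≡ᵇ_ : Carrier → Carrier → Bool
  _≤ᵇ_ = Defs._≤ᵇ_ Q
  _<ᵇ_ = Defs._<ᵇ_ Q
  _≡ᵇ_ = Defs._≡ᵇ_ Q

  ≤ᵇ-true : ∀ {x y} → x ≤ y → x ≤ᵇ y ≡ true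
  ≤ᵇ-true {x} {y} = dec-true (x ≤? y)

  ≤ᵇ-false : ∀ {x y} → ¬ x ≤ y → x ≤ᵇ y ≡ false
  ≤ᵇ-false {x} {y} = dec-false (x ≤? y)

  ≡ᵇ-true : ∀ {x y} → x ≡ y → x ≡ᵇ y ≡ true
  ≡ᵇ-true {x} {y} = dec-true (x ≟ y)

  ≡ᵇ-false : ∀ {x y} → x ≢ y → x ≡ᵇ y ≡ false
  ≡ᵇ-false {x} {y} = dec-false (x ≟ y)

  ≡ᵇ-comm : ∀ x y → x ≡ᵇ y ≡ y ≡ᵇ x
  ≡ᵇ-comm x y with x ≟ y | y ≟ x
  ... | yes _    | yes _ = refl
  ... | no _     | no _  = refl
  ... | yes refl | no x≢x = contradiction refl x≢x
  ... | no x≢x   | yes refl = contradiction refl x≢x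

  ≤ᵇ-sound : ∀ {x y} → x ≤ᵇ y ≡ true → x ≤ y
  ≤ᵇ-sound {x} {y} e with x ≤? y
  ... | yes x≤y = x≤y
  ≤ᵇ-sound () | no _

  <ᵇ-true : ∀ {x y} → x < y → x <ᵇ y ≡ true
  <ᵇ-true (x≤y , x≢y) = cong₂ (λ a b → a ∧ not b) (≤ᵇ-true x≤y) (≡ᵇ-false x≢y)

  <ᵇ-irrefl : ∀ x → x <ᵇ x ≡ false
  <ᵇ-irrefl x = trans (cong (λ b → (x ≤ᵇ x) ∧ not b) (≡ᵇ-true {x} refl)) (∧-zeroʳ _)

  <ᵇ-sound : ∀ {x y} → x <ᵇ y ≡ true → x < y
  <ᵇ-sound {x} {y} e with x ≤? y | x ≟ y
  ... | yes x≤y | no x≢y = x≤y , x≢y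
  <ᵇ-sound () | yes _ | yes _
  <ᵇ-sound () | no _  | _

module PartialOrder (Q : PosetData)
  (refl≤ : ∀ x → PosetData._≤_ Q x x)
  (antisym : ∀ {x y} → PosetData._≤_ Q x y → PosetData._≤_ Q y x → x ≡ y)
  (trans≤ : ∀ {x y z} → PosetData._≤_ Q x y → PosetData._≤_ Q y z → PosetData._≤_ Q x z) where
  open PosetData Q
  open Order Q public

  <-≤-trans : ∀ {x y z} → x < y → y ≤ z → x < z
  <-≤-trans (x≤y , x≢y) y≤z = trans≤ x≤y y≤z , λ { refl → x≢y (antisym x≤y y≤z) }

  ≤-<-trans : ∀ {x y z} → x ≤ y → y < z → x < z
  ≤-<-trans x≤y (y≤z , y≢z) = trans≤ x≤y y≤z , λ { refl → y≢z (antisym y≤z x≤y) }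

  ≤ᵇ-split : ∀ x y → x ≤ᵇ y ≡ (x ≡ᵇ y) ∨ (x <ᵇ y)
  ≤ᵇ-split x y with x ≟ y
  ... | yes refl = ≤ᵇ-true (refl≤ x)
  ... | no _     = sym (∧-identityʳ _)

  ≡ᵇ-∧-<ᵇ : ∀ x y → (x ≡ᵇ y) ∧ (x <ᵇ y) ≡ false
  ≡ᵇ-∧-<ᵇ x y with x ≟ y
  ... | yes _ = ∧-zeroʳ _
  ... | no _  = refl

  -- Each recursive call of mobius (resp. chowInterval) on [x,y] shrinks the half-open
  -- interval [x,y) (resp. (x,y]), which omits y (resp. x) and so is shorter than elems.
  ∣[_,_⟩∣ ∣⟨_,_]∣ : Carrier → Carrier → ℕ
  ∣[ x , y ⟩∣ = length (filterᵇ (λ w → (x ≤ᵇ w) ∧ (w <ᵇ y)) elems)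
  ∣⟨ x , y ]∣ = length (filterᵇ (λ w → (x <ᵇ w) ∧ (w ≤ᵇ y)) elems)

  ∣[,⟩∣<length : ∀ {x y} → y ∈ elems → ∣[ x , y ⟩∣ ℕ.< length elems
  ∣[,⟩∣<length {x} {y} y∈ =
    length-filterᵇ-reject (λ w → (x ≤ᵇ w) ∧ (w <ᵇ y)) elems y∈
      (trans (cong ((x ≤ᵇ y) ∧_) (<ᵇ-irrefl y)) (∧-zeroʳ _))

  ∣⟨,]∣<length : ∀ {x y} → x ∈ elems → ∣⟨ x , y ]∣ ℕ.< length elems
  ∣⟨,]∣<length {x} {y} x∈ =
    length-filterᵇ-reject (λ w → (x <ᵇ w) ∧ (w ≤ᵇ y)) elems x∈ (cong (_∧ (x ≤ᵇ y)) (<ᵇ-irrefl x))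

  ∣[,⟩∣-shrink : ∀ {x w y} → w ∈ elems → x ≤ w → w < y → ∣[ x , w ⟩∣ ℕ.< ∣[ x , y ⟩∣
  ∣[,⟩∣-shrink {x} {w} {y} w∈ x≤w w<y =
    length-filterᵇ-< (λ v → (x ≤ᵇ v) ∧ (v <ᵇ w)) (λ v → (x ≤ᵇ v) ∧ (v <ᵇ y)) elems
      (λ {v} _ e → let (x≤v , v<w) = ∧-true⁻ {x ≤ᵇ v} e in
               cong₂ _∧_ x≤v (<ᵇ-true (<-≤-trans (<ᵇ-sound v<w) (proj₁ w<y))))
      w∈ (cong₂ _∧_ (≤ᵇ-true x≤w) (<ᵇ-true w<y))
      (trans (cong ((x ≤ᵇ w) ∧_) (<ᵇ-irrefl w)) (∧-zeroʳ _))

  ∣⟨,]∣-shrink : ∀ {x z y} → z ∈ elems → x < z → z ≤ y → ∣⟨ z , y ]∣ ℕ.< ∣⟨ x , y ]∣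
  ∣⟨,]∣-shrink {x} {z} {y} z∈ x<z z≤y =
    length-filterᵇ-< (λ v → (z <ᵇ v) ∧ (v ≤ᵇ y)) (λ v → (x <ᵇ v) ∧ (v ≤ᵇ y)) elems
      (λ {v} _ e → let (z<v , v≤y) = ∧-true⁻ {z <ᵇ v} e in
               cong₂ _∧_ (<ᵇ-true (≤-<-trans (proj₁ x<z) (<ᵇ-sound z<v))) v≤y)
      z∈ (cong₂ _∧_ (<ᵇ-true x<z) (≤ᵇ-true z≤y))
      (cong (_∧ (z ≤ᵇ y)) (<ᵇ-irrefl z))

  ∣⟨,]∣-shrinkʳ : ∀ {x z y} → y ∈ elems → x < z → z < y → ∣⟨ x , z ]∣ ℕ.< ∣⟨ x , y ]∣
  ∣⟨,]∣-shrinkʳ {x} {z} {y} y∈ x<z (z≤y , z≢y) =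
    length-filterᵇ-< (λ v → (x <ᵇ v) ∧ (v ≤ᵇ z)) (λ v → (x <ᵇ v) ∧ (v ≤ᵇ y)) elems
      (λ {v} _ e → let (x<v , v≤z) = ∧-true⁻ {x <ᵇ v} e in cong₂ _∧_ x<v (≤ᵇ-true (trans≤ (≤ᵇ-sound v≤z) z≤y)))
      y∈ (cong₂ _∧_ (<ᵇ-true x<y) (≤ᵇ-true (refl≤ y)))
      (trans (cong ((x <ᵇ y) ∧_) (≤ᵇ-false λ y≤z → z≢y (antisym z≤y y≤z))) (∧-zeroʳ _))
    where
    x<y : x < y
    x<y = <-≤-trans x<z z≤y

  mobiusFuel-stable : ∀ n m {x y} → ∣[ x , y ⟩∣ ℕ.< n → ∣[ x , y ⟩∣ ℕ.< m →
                      mobiusFuel Q n x y ≡ mobiusFuel Q m x y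
  mobiusFuel-stable (suc n) (suc m) {x} {y} (s≤s hn) (s≤s hm) =
    cong (λ s → if x ≡ᵇ y then 1ℤ else if x ≤ᵇ y then ℤ.- sumℤ s else 0ℤ)
      (map-cong-∈ (filterᵇ (λ w → (x ≤ᵇ w) ∧ (w <ᵇ y)) elems) λ {w} w∈ →
        let (w∈E , e)   = ∈-filterᵇ⁻ _ elems w∈
            (x≤w , w<y) = ∧-true⁻ {x ≤ᵇ w} e
            shrink      = ∣[,⟩∣-shrink w∈E (≤ᵇ-sound x≤w) (<ᵇ-sound w<y)
        in mobiusFuel-stable n m (ℕP.<-≤-trans shrink hn) (ℕP.<-≤-trans shrink hm))

  chowFuel-stable : ∀ n m {x y} → ∣⟨ x , y ]∣ ℕ.< n → ∣⟨ x , y ]∣ ℕ.< m →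
                    chowFuel Q n x y ≡ chowFuel Q m x y
  chowFuel-stable (suc n) (suc m) {x} {y} (s≤s hn) (s≤s hm) =
    cong (λ s → if x ≡ᵇ y then oneₚ else sumₚ s)
      (map-cong-∈ (filterᵇ (λ z → (x <ᵇ z) ∧ (z ≤ᵇ y)) elems) λ {z} z∈ →
        let (z∈E , e)   = ∈-filterᵇ⁻ _ elems z∈
            (x<z , z≤y) = ∧-true⁻ {x <ᵇ z} e
            shrink      = ∣⟨,]∣-shrink z∈E (<ᵇ-sound x<z) (≤ᵇ-sound z≤y)
        in cong (redCharPoly Q x z *ₚ_) (chowFuel-stable n m (ℕP.<-≤-trans shrink hn) (ℕP.<-≤-trans shrink hm)))

  mobius≡mobiusFuel : ∀ {x y} n → y ∈ elems → ∣[ x , y ⟩∣ ℕ.< n → mobius Q x y ≡ mobiusFuel Q n x y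
  mobius≡mobiusFuel n y∈ = mobiusFuel-stable (length elems) n (∣[,⟩∣<length y∈)

  chowInterval≡chowFuel : ∀ {x y} n → x ∈ elems → ∣⟨ x , y ]∣ ℕ.< n → chowInterval Q x y ≡ chowFuel Q n x y
  chowInterval≡chowFuel n x∈ = chowFuel-stable (length elems) n (∣⟨,]∣<length x∈)

  mobius-refl : ∀ {x} → x ∈ elems → mobius Q x x ≡ 1ℤ
  mobius-refl {x} x∈ rewrite mobius≡mobiusFuel (suc ∣[ x , x ⟩∣) x∈ ℕP.≤-refl | ≡ᵇ-true {x} refl = refl

  mobius-step : ∀ {x y} → y ∈ elems → x < y →
                mobius Q x y ≡ ℤ.- sumℤ (map (mobius Q x) (filterᵇ (λ w → (x ≤ᵇ w) ∧ (w <ᵇ y)) elems))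
  mobius-step {x} {y} y∈ (x≤y , x≢y)
    rewrite mobius≡mobiusFuel (suc ∣[ x , y ⟩∣) y∈ ℕP.≤-refl | ≡ᵇ-false x≢y | ≤ᵇ-true x≤y =
    cong (λ s → ℤ.- sumℤ s) (map-cong-∈ (filterᵇ (λ w → (x ≤ᵇ w) ∧ (w <ᵇ y)) elems) λ {w} w∈ →
      let (w∈E , e)   = ∈-filterᵇ⁻ _ elems w∈
          (x≤w , w<y) = ∧-true⁻ {x ≤ᵇ w} e
      in sym (mobius≡mobiusFuel _ w∈E (∣[,⟩∣-shrink w∈E (≤ᵇ-sound x≤w) (<ᵇ-sound w<y))))

  chow-refl : ∀ {x} → x ∈ elems → chowInterval Q x x ≡ oneₚ
  chow-refl {x} x∈ rewrite chowInterval≡chowFuel (suc ∣⟨ x , x ]∣) x∈ ℕP.≤-refl | ≡ᵇ-true {x} refl = refl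

  chow-step : ∀ {x y} → x ∈ elems → x ≢ y →
              chowInterval Q x y ≡ sumₚ (map (λ z → redCharPoly Q x z *ₚ chowInterval Q z y)
                                             (filterᵇ (λ z → (x <ᵇ z) ∧ (z ≤ᵇ y)) elems))
  chow-step {x} {y} x∈ x≢y rewrite chowInterval≡chowFuel (suc ∣⟨ x , y ]∣) x∈ ℕP.≤-refl | ≡ᵇ-false x≢y =
    cong sumₚ (map-cong-∈ (filterᵇ (λ z → (x <ᵇ z) ∧ (z ≤ᵇ y)) elems) λ {z} z∈ →
      let (z∈E , e)   = ∈-filterᵇ⁻ _ elems z∈
          (x<z , z≤y) = ∧-true⁻ {x <ᵇ z} e
      in cong (redCharPoly Q x z *ₚ_)
              (sym (chowInterval≡chowFuel _ z∈E (∣⟨,]∣-shrink z∈E (<ᵇ-sound x<z) (≤ᵇ-sound z≤y)))))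

-- IsBoundedGraded relative to the element list, with gradedness weakened to a strictly
-- monotone rank: unlike IsBoundedGraded this survives σ, whose elems omit the atoms.
record IsBoundedRanked (Q : PosetData) : Set where
  open PosetData Q
  open Order Q using (_<_)
  field
    unique    : Unique elems
    bot∈      : bot ∈ elems
    top∈      : top ∈ elems
    refl≤     : ∀ x → x ≤ x
    antisym   : ∀ {x y} → x ≤ y → y ≤ x → x ≡ y
    trans≤    : ∀ {x y z} → x ≤ y → y ≤ z → x ≤ z
    bot≤      : ∀ {x} → x ∈ elems → bot ≤ x
    ≤top      : ∀ {x} → x ∈ elems → x ≤ top
    rank-bot  : rank bot ≡ 0
    rank-mono : ∀ {x y} → x ∈ elems → y ∈ elems → x < y → rank x ℕ.< rank y

module BoundedRanked {Q : PosetData} (R : IsBoundedRanked Q) where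
  open PosetData Q
  open IsBoundedRanked R
  open PartialOrder Q refl≤ antisym trans≤ public

  rank-≤ : ∀ {x y} → x ∈ elems → y ∈ elems → x ≤ y → rank x ℕ.≤ rank y
  rank-≤ {x} {y} x∈ y∈ x≤y with x ≟ y
  ... | yes refl = ℕP.≤-refl
  ... | no x≢y   = ℕP.<⇒≤ (rank-mono x∈ y∈ (x≤y , x≢y))

  rank<top : ∀ {x} → x ∈ elems → x ≢ top → rank x ℕ.< rank top
  rank<top x∈ x≢top = rank-mono x∈ top∈ (≤top x∈ , x≢top)

  <ᵇ-bot : ∀ {z} → z ∈ elems → bot <ᵇ z ≡ (1 ℕ.≤ᵇ rank z)
  <ᵇ-bot {z} z∈ with bot ≟ z
  ... | yes refl rewrite rank-bot = ∧-zeroʳ _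
  ... | no bot≢z = trans (cong₂ _∧_ (≤ᵇ-true (bot≤ z∈)) refl)
                         (sym (ℕ≤ᵇ-true (subst (ℕ._< rank z) rank-bot (rank-mono bot∈ z∈ (bot≤ z∈ , bot≢z)))))

  top-maximal : ∀ {z} → z ∈ elems → top <ᵇ z ≡ false
  top-maximal {z} z∈ with top ≤? z
  ... | yes top≤z = cong not (≡ᵇ-true (antisym top≤z (≤top z∈)))
  ... | no _      = refl

  rank≡0⇒bot : ∀ {x} → x ∈ elems → rank x ≡ 0 → x ≡ bot
  rank≡0⇒bot {x} x∈ rank≡0 with bot ≟ x
  ... | yes bot≡x = sym bot≡x
  ... | no bot≢x  = contradiction (subst₂ ℕ._<_ rank-bot rank≡0 (rank-mono bot∈ x∈ (bot≤ x∈ , bot≢x))) (λ ())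

-- The Möbius-inverted recursion for Chow polynomials

chowSumFromRank : ℕ → PosetData → Poly
chowSumFromRank m Q = ∑[ z ∈ elems ] ⟦ m ℕ.≤ᵇ rank z ⟧ *ₚ chowInterval Q z top
  where open PosetData Q

weightedChowSum : PosetData → Poly
weightedChowSum Q = ∑[ z ∈ elems ] ⟦ 2 ℕ.≤ᵇ rank z ⟧ *ₚ ([ rank z ∸ 1 ]ₜ *ₚ chowInterval Q z top)
  where open PosetData Q

module UpperSums {Q : PosetData} (R : IsBoundedRanked Q) where
  open PosetData Q
  open IsBoundedRanked R
  open BoundedRanked R

  H : Carrier → Poly
  H x = chowInterval Q x top

  μ : Carrier → Carrier → Poly
  μ x w = constₚ (mobius Q x w)

  ∑-δ-split : ∀ {c} → c ∈ elems → (b d : Carrier → Bool) →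
              (∀ w → b w ≡ (c ≡ᵇ w) ∨ d w) → (∀ w → (c ≡ᵇ w) ∧ d w ≡ false) → (g : Carrier → Poly) →
              ∑[ w ∈ elems ] ⟦ b w ⟧ *ₚ g w ≋ g c +ₚ (∑[ w ∈ elems ] ⟦ d w ⟧ *ₚ g w)
  ∑-δ-split {c} c∈ b d b≡ disjoint g = begin
    ∑[ w ∈ elems ] ⟦ b w ⟧ *ₚ g w
      ≈⟨ ∑-cong elems (λ {w} _ →
           *ₚ-cong (≋-trans (≋-reflexive (cong ⟦_⟧ (b≡ w))) (⟦∨⟧ (c ≡ᵇ w) (d w) (disjoint w))) ≋-refl) ⟩
    ∑[ w ∈ elems ] (⟦ c ≡ᵇ w ⟧ +ₚ ⟦ d w ⟧) *ₚ g w
      ≈⟨ ∑-cong elems (λ {w} _ → *ₚ-distribʳ (g w) ⟦ c ≡ᵇ w ⟧ ⟦ d w ⟧) ⟩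
    ∑[ w ∈ elems ] (⟦ c ≡ᵇ w ⟧ *ₚ g w +ₚ ⟦ d w ⟧ *ₚ g w)
      ≈⟨ ∑-+ elems _ _ ⟩
    (∑[ w ∈ elems ] ⟦ c ≡ᵇ w ⟧ *ₚ g w) +ₚ (∑[ w ∈ elems ] ⟦ d w ⟧ *ₚ g w)
      ≈⟨ +ₚ-cong (∑-δ _≟_ g unique c∈) ≋-refl ⟩
    g c +ₚ (∑[ w ∈ elems ] ⟦ d w ⟧ *ₚ g w) ∎

  ∑-≤ᵇ-splitˡ : ∀ {x} → x ∈ elems → (g : Carrier → Poly) →
                ∑[ w ∈ elems ] ⟦ x ≤ᵇ w ⟧ *ₚ g w ≋ g x +ₚ (∑[ w ∈ elems ] ⟦ x <ᵇ w ⟧ *ₚ g w)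
  ∑-≤ᵇ-splitˡ {x} x∈ = ∑-δ-split x∈ (x ≤ᵇ_) (x <ᵇ_) (≤ᵇ-split x) (≡ᵇ-∧-<ᵇ x)

  ∑-≤ᵇ-splitʳ : ∀ {z} → z ∈ elems → (g : Carrier → Poly) →
                ∑[ w ∈ elems ] ⟦ w ≤ᵇ z ⟧ *ₚ g w ≋ g z +ₚ (∑[ w ∈ elems ] ⟦ w <ᵇ z ⟧ *ₚ g w)
  ∑-≤ᵇ-splitʳ {z} z∈ = ∑-δ-split z∈ (_≤ᵇ z) (_<ᵇ z)
    (λ w → trans (≤ᵇ-split w z) (cong (_∨ (w <ᵇ z)) (≡ᵇ-comm w z)))
    (λ w → trans (cong (_∧ (w <ᵇ z)) (≡ᵇ-comm z w)) (≡ᵇ-∧-<ᵇ w z))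

  mobius-∑-closed : ∀ {x z} → z ∈ elems → x < z →
                    ∑[ w ∈ elems ] ⟦ x ≤ᵇ w ⟧ *ₚ (⟦ w ≤ᵇ z ⟧ *ₚ μ x w) ≋ []
  mobius-∑-closed {x} {z} z∈ x<z = begin
    ∑[ w ∈ elems ] ⟦ x ≤ᵇ w ⟧ *ₚ (⟦ w ≤ᵇ z ⟧ *ₚ μ x w)
      ≈⟨ ∑-cong elems (λ {w} _ →
           solve 3 (λ a b m → a :* (b :* m) := b :* (a :* m)) ≋-refl ⟦ x ≤ᵇ w ⟧ ⟦ w ≤ᵇ z ⟧ (μ x w)) ⟩
    ∑[ w ∈ elems ] ⟦ w ≤ᵇ z ⟧ *ₚ (⟦ x ≤ᵇ w ⟧ *ₚ μ x w)
      ≈⟨ ∑-≤ᵇ-splitʳ z∈ (λ w → ⟦ x ≤ᵇ w ⟧ *ₚ μ x w) ⟩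
    ⟦ x ≤ᵇ z ⟧ *ₚ μ x z +ₚ (∑[ w ∈ elems ] ⟦ w <ᵇ z ⟧ *ₚ (⟦ x ≤ᵇ w ⟧ *ₚ μ x w))
      ≈⟨ +ₚ-cong (≋-trans (*ₚ-cong (≋-reflexive (cong ⟦_⟧ (≤ᵇ-true (proj₁ x<z)))) ≋-refl) (*ₚ-identityˡ _))
                 (∑-cong elems (λ {w} _ → ≋-trans
                   (solve 3 (λ a b m → b :* (a :* m) := (a :* b) :* m) ≋-refl ⟦ x ≤ᵇ w ⟧ ⟦ w <ᵇ z ⟧ (μ x w))
                   (*ₚ-cong (≋-sym (⟦∧⟧ (x ≤ᵇ w) (w <ᵇ z))) ≋-refl))) ⟩
    μ x z +ₚ (∑[ w ∈ elems ] ⟦ (x ≤ᵇ w) ∧ (w <ᵇ z) ⟧ *ₚ μ x w)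
      ≈⟨ +ₚ-cong ≋-refl (≋-sym (∑-filterᵇ _ elems (μ x))) ⟩
    μ x z +ₚ ∑ [x,z⟩ (μ x)
      ≈⟨ +ₚ-cong (≋-trans (≋-reflexive (cong constₚ (mobius-step z∈ x<z))) (constₚ-neg _))
                 (≋-sym (constₚ-sumℤ (mobius Q x) [x,z⟩)) ⟩
    negₚ (constₚ s) +ₚ constₚ s
      ≈⟨ -‿inverseˡ (constₚ s) ⟩
    [] ∎
    where
    [x,z⟩ : List Carrier
    [x,z⟩ = filterᵇ (λ w → (x ≤ᵇ w) ∧ (w <ᵇ z)) elems
    s : ℤ
    s = sumℤ (map (mobius Q x) [x,z⟩)

  mobius-∑ : ∀ {x z} → x ∈ elems → z ∈ elems →
             ∑[ w ∈ elems ] ⟦ x <ᵇ w ⟧ *ₚ (⟦ w ≤ᵇ z ⟧ *ₚ μ x w) ≋ negₚ ⟦ x <ᵇ z ⟧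
  mobius-∑ {x} {z} x∈ z∈ with x <ᵇ z in x<z
  ... | true  = begin
    A                                  ≈⟨ solve 1 (λ a → a := (con 1ℤ :+ a) :- con 1ℤ) ≋-refl A ⟩
    (oneₚ +ₚ A) +ₚ negₚ oneₚ           ≈⟨ +ₚ-cong closed ≋-refl ⟩
    [] +ₚ negₚ oneₚ                    ∎
    where
    A : Poly
    A = ∑[ w ∈ elems ] ⟦ x <ᵇ w ⟧ *ₚ (⟦ w ≤ᵇ z ⟧ *ₚ μ x w)
    closed : oneₚ +ₚ A ≋ []
    closed = begin
      oneₚ +ₚ A
        ≈⟨ +ₚ-cong (≋-sym (≋-trans (*ₚ-cong (≋-reflexive (cong ⟦_⟧ (≤ᵇ-true (proj₁ (<ᵇ-sound x<z)))))
                                            (≋-reflexive (cong constₚ (mobius-refl x∈))))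
                                   (*ₚ-identityˡ oneₚ))) ≋-refl ⟩
      ⟦ x ≤ᵇ z ⟧ *ₚ μ x x +ₚ A
        ≈⟨ ∑-≤ᵇ-splitˡ x∈ (λ w → ⟦ w ≤ᵇ z ⟧ *ₚ μ x w) ⟨
      ∑[ w ∈ elems ] ⟦ x ≤ᵇ w ⟧ *ₚ (⟦ w ≤ᵇ z ⟧ *ₚ μ x w)
        ≈⟨ mobius-∑-closed z∈ (<ᵇ-sound x<z) ⟩
      [] ∎
  ... | false = ∑-zero elems vanish
    where
    vanish : ∀ {w} → w ∈ elems → ⟦ x <ᵇ w ⟧ *ₚ (⟦ w ≤ᵇ z ⟧ *ₚ μ x w) ≋ []
    vanish {w} _ with x <ᵇ w in x<w | w ≤ᵇ z in w≤z
    ... | true  | true  = contradiction (trans (sym (<ᵇ-true (<-≤-trans (<ᵇ-sound x<w) (≤ᵇ-sound w≤z)))) x<z) λ ()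
    ... | true  | false = *ₚ-zeroʳ oneₚ
    ... | false | _     = ≋-refl

  K : Carrier → Poly
  K x = ∑[ z ∈ elems ] ⟦ x <ᵇ z ⟧ *ₚ H z

  mobius-convolution : ∀ {x} → x ∈ elems →
    ∑[ w ∈ elems ] ⟦ x <ᵇ w ⟧ *ₚ (μ x w *ₚ (∑[ z ∈ elems ] ⟦ w ≤ᵇ z ⟧ *ₚ H z)) ≋ negₚ (K x)
  mobius-convolution {x} x∈ = begin
    ∑[ w ∈ elems ] ⟦ x <ᵇ w ⟧ *ₚ (μ x w *ₚ (∑[ z ∈ elems ] ⟦ w ≤ᵇ z ⟧ *ₚ H z))
      ≈⟨ ∑-cong elems (λ {w} _ → distribute w) ⟩
    ∑[ w ∈ elems ] ∑[ z ∈ elems ] (⟦ x <ᵇ w ⟧ *ₚ (⟦ w ≤ᵇ z ⟧ *ₚ μ x w)) *ₚ H z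
      ≈⟨ ∑-swap elems elems _ ⟩
    ∑[ z ∈ elems ] ∑[ w ∈ elems ] (⟦ x <ᵇ w ⟧ *ₚ (⟦ w ≤ᵇ z ⟧ *ₚ μ x w)) *ₚ H z
      ≈⟨ ∑-cong elems (λ {z} z∈ → ≋-trans (≋-sym (∑-* (H z) elems _)) (*ₚ-cong (mobius-∑ x∈ z∈) ≋-refl)) ⟩
    ∑[ z ∈ elems ] negₚ ⟦ x <ᵇ z ⟧ *ₚ H z
      ≈⟨ ∑-cong elems (λ {z} _ → solve 2 (λ a h → (:- a) :* h := :- (a :* h)) ≋-refl ⟦ x <ᵇ z ⟧ (H z)) ⟩
    ∑[ z ∈ elems ] negₚ (⟦ x <ᵇ z ⟧ *ₚ H z)
      ≈⟨ ∑-negₚ elems _ ⟩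
    negₚ (K x) ∎
    where
    distribute : ∀ w → ⟦ x <ᵇ w ⟧ *ₚ (μ x w *ₚ (∑[ z ∈ elems ] ⟦ w ≤ᵇ z ⟧ *ₚ H z)) ≋
                       ∑[ z ∈ elems ] (⟦ x <ᵇ w ⟧ *ₚ (⟦ w ≤ᵇ z ⟧ *ₚ μ x w)) *ₚ H z
    distribute w = begin
      ⟦ x <ᵇ w ⟧ *ₚ (μ x w *ₚ (∑[ z ∈ elems ] ⟦ w ≤ᵇ z ⟧ *ₚ H z))
        ≈⟨ *ₚ-congʳ ⟦ x <ᵇ w ⟧ (*-∑ (μ x w) elems _) ⟩
      ⟦ x <ᵇ w ⟧ *ₚ (∑[ z ∈ elems ] μ x w *ₚ (⟦ w ≤ᵇ z ⟧ *ₚ H z))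
        ≈⟨ *-∑ ⟦ x <ᵇ w ⟧ elems _ ⟩
      ∑[ z ∈ elems ] ⟦ x <ᵇ w ⟧ *ₚ (μ x w *ₚ (⟦ w ≤ᵇ z ⟧ *ₚ H z))
        ≈⟨ ∑-cong elems (λ {z} _ → solve 4 (λ a m b h → a :* (m :* (b :* h)) := (a :* (b :* m)) :* h)
                                            ≋-refl ⟦ x <ᵇ w ⟧ (μ x w) ⟦ w ≤ᵇ z ⟧ (H z)) ⟩
      ∑[ z ∈ elems ] (⟦ x <ᵇ w ⟧ *ₚ (⟦ w ≤ᵇ z ⟧ *ₚ μ x w)) *ₚ H z ∎

  redCharPoly-expansion : ∀ {x z} → x ≢ z →
    redCharPoly Q x z ≋ ∑[ w ∈ elems ] ⟦ x ≤ᵇ w ⟧ *ₚ (⟦ w ≤ᵇ z ⟧ *ₚ (μ x w *ₚ [ rank z ∸ rank w ]ₜ))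
  redCharPoly-expansion {x} {z} x≢z = begin
    redCharPoly Q x z
      ≡⟨ cong (λ b → if b then constₚ -1ℤ else divByTMinus1 (charPoly Q x z)) (≡ᵇ-false x≢z) ⟩
    divByTMinus1 (∑ [x,z] (λ w → monomial (mobius Q x w) (rank z ∸ rank w)))
      ≈⟨ divByTMinus1-∑ [x,z] _ ⟩
    ∑[ w ∈ [x,z] ] divByTMinus1 (monomial (mobius Q x w) (rank z ∸ rank w))
      ≈⟨ ∑-cong [x,z] (λ {w} _ → divByTMinus1-monomial (mobius Q x w) (rank z ∸ rank w)) ⟩
    ∑[ w ∈ [x,z] ] μ x w *ₚ [ rank z ∸ rank w ]ₜ
      ≈⟨ ∑-filterᵇ _ elems _ ⟩
    ∑[ w ∈ elems ] ⟦ (x ≤ᵇ w) ∧ (w ≤ᵇ z) ⟧ *ₚ (μ x w *ₚ [ rank z ∸ rank w ]ₜ)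
      ≈⟨ ∑-cong elems (λ {w} _ →
           ≋-trans (*ₚ-cong (⟦∧⟧ (x ≤ᵇ w) (w ≤ᵇ z)) ≋-refl) (*ₚ-assoc ⟦ x ≤ᵇ w ⟧ ⟦ w ≤ᵇ z ⟧ _)) ⟩
    ∑[ w ∈ elems ] ⟦ x ≤ᵇ w ⟧ *ₚ (⟦ w ≤ᵇ z ⟧ *ₚ (μ x w *ₚ [ rank z ∸ rank w ]ₜ)) ∎
    where
    [x,z] : List Carrier
    [x,z] = filterᵇ (λ w → (x ≤ᵇ w) ∧ (w ≤ᵇ z)) elems

  B : Carrier → Poly
  B x = ∑[ z ∈ elems ] ⟦ x <ᵇ z ⟧ *ₚ ([ rank z ∸ rank x ]ₜ *ₚ H z)

  -- The diagonal term vanishes because [ 0 ]ₜ = 0.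
  B-summand : ∀ {x w z} → x ≤ w →
    ⟦ x <ᵇ z ⟧ *ₚ (⟦ w ≤ᵇ z ⟧ *ₚ ([ rank z ∸ rank w ]ₜ *ₚ H z)) ≋ ⟦ w <ᵇ z ⟧ *ₚ ([ rank z ∸ rank w ]ₜ *ₚ H z)
  B-summand {x} {w} {z} x≤w with w ≟ z
  ... | yes refl rewrite ℕP.n∸n≡0 (rank w) =
    ≋-trans (≋-trans (*ₚ-congʳ ⟦ x <ᵇ w ⟧ (*ₚ-zeroʳ ⟦ w ≤ᵇ w ⟧)) (*ₚ-zeroʳ ⟦ x <ᵇ w ⟧))
            (≋-sym (*ₚ-zeroʳ ⟦ (w ≤ᵇ w) ∧ false ⟧))
  ... | no w≢z with w ≤ᵇ z in w≤z
  ...   | false = *ₚ-zeroʳ ⟦ x <ᵇ z ⟧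
  ...   | true rewrite <ᵇ-true (≤-<-trans x≤w (≤ᵇ-sound w≤z , w≢z)) = *ₚ-identityˡ _

  chow-expansion : ∀ {x} → x ∈ elems → x ≢ top → H x ≋ ∑[ w ∈ elems ] ⟦ x ≤ᵇ w ⟧ *ₚ (μ x w *ₚ B w)
  chow-expansion {x} x∈ x≢top = begin
    H x
      ≡⟨ chow-step x∈ x≢top ⟩
    ∑[ z ∈ filterᵇ (λ z → (x <ᵇ z) ∧ (z ≤ᵇ top)) elems ] redCharPoly Q x z *ₚ H z
      ≈⟨ ∑-filterᵇ _ elems _ ⟩
    ∑[ z ∈ elems ] ⟦ (x <ᵇ z) ∧ (z ≤ᵇ top) ⟧ *ₚ (redCharPoly Q x z *ₚ H z)
      ≈⟨ ∑-cong elems expand ⟩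
    ∑[ z ∈ elems ] ∑[ w ∈ elems ] ⟦ x ≤ᵇ w ⟧ *ₚ (μ x w *ₚ term w z)
      ≈⟨ ∑-swap elems elems _ ⟩
    ∑[ w ∈ elems ] ∑[ z ∈ elems ] ⟦ x ≤ᵇ w ⟧ *ₚ (μ x w *ₚ term w z)
      ≈⟨ ∑-cong elems (λ {w} _ → factor w) ⟩
    ∑[ w ∈ elems ] ⟦ x ≤ᵇ w ⟧ *ₚ (μ x w *ₚ (∑[ z ∈ elems ] term w z))
      ≈⟨ ∑-cong elems (λ {w} _ → collapse w) ⟩
    ∑[ w ∈ elems ] ⟦ x ≤ᵇ w ⟧ *ₚ (μ x w *ₚ B w) ∎
    where
    term : Carrier → Carrier → Poly
    term w z = ⟦ x <ᵇ z ⟧ *ₚ (⟦ w ≤ᵇ z ⟧ *ₚ ([ rank z ∸ rank w ]ₜ *ₚ H z))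

    expand : ∀ {z} → z ∈ elems → ⟦ (x <ᵇ z) ∧ (z ≤ᵇ top) ⟧ *ₚ (redCharPoly Q x z *ₚ H z) ≋
                                 ∑[ w ∈ elems ] ⟦ x ≤ᵇ w ⟧ *ₚ (μ x w *ₚ term w z)
    expand {z} z∈ with x <ᵇ z in x<z
    ... | false = ≋-sym (∑-zero elems (λ {w} _ →
                    ≋-trans (*ₚ-congʳ ⟦ x ≤ᵇ w ⟧ (*ₚ-zeroʳ (μ x w))) (*ₚ-zeroʳ ⟦ x ≤ᵇ w ⟧)))
    ... | true rewrite ≤ᵇ-true (≤top z∈) = begin
      oneₚ *ₚ (redCharPoly Q x z *ₚ H z)
        ≈⟨ *ₚ-identityˡ _ ⟩
      redCharPoly Q x z *ₚ H z
        ≈⟨ *ₚ-cong (redCharPoly-expansion (proj₂ (<ᵇ-sound x<z))) ≋-refl ⟩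
      (∑[ w ∈ elems ] ⟦ x ≤ᵇ w ⟧ *ₚ (⟦ w ≤ᵇ z ⟧ *ₚ (μ x w *ₚ [ rank z ∸ rank w ]ₜ))) *ₚ H z
        ≈⟨ ∑-* (H z) elems _ ⟩
      ∑[ w ∈ elems ] (⟦ x ≤ᵇ w ⟧ *ₚ (⟦ w ≤ᵇ z ⟧ *ₚ (μ x w *ₚ [ rank z ∸ rank w ]ₜ))) *ₚ H z
        ≈⟨ ∑-cong elems (λ {w} _ → solve 5 (λ a b m r h → (a :* (b :* (m :* r))) :* h := a :* (m :* (con 1ℤ :* (b :* (r :* h)))))
                                            ≋-refl ⟦ x ≤ᵇ w ⟧ ⟦ w ≤ᵇ z ⟧ (μ x w) [ rank z ∸ rank w ]ₜ (H z)) ⟩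
      ∑[ w ∈ elems ] ⟦ x ≤ᵇ w ⟧ *ₚ (μ x w *ₚ (oneₚ *ₚ (⟦ w ≤ᵇ z ⟧ *ₚ ([ rank z ∸ rank w ]ₜ *ₚ H z)))) ∎

    factor : ∀ w → (∑[ z ∈ elems ] ⟦ x ≤ᵇ w ⟧ *ₚ (μ x w *ₚ term w z)) ≋
                   ⟦ x ≤ᵇ w ⟧ *ₚ (μ x w *ₚ (∑[ z ∈ elems ] term w z))
    factor w = ≋-sym (≋-trans (*ₚ-congʳ ⟦ x ≤ᵇ w ⟧ (*-∑ (μ x w) elems (term w))) (*-∑ ⟦ x ≤ᵇ w ⟧ elems _))

    collapse : ∀ w → ⟦ x ≤ᵇ w ⟧ *ₚ (μ x w *ₚ (∑[ z ∈ elems ] term w z)) ≋ ⟦ x ≤ᵇ w ⟧ *ₚ (μ x w *ₚ B w)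
    collapse w with x ≤ᵇ w in x≤w
    ... | false = ≋-refl
    ... | true  = *ₚ-congʳ oneₚ (*ₚ-congʳ (μ x w) (∑-cong elems (λ _ → B-summand (≤ᵇ-sound x≤w))))

  chow-upper-identity-top : H top +ₚ K top ≋ oneₚ +ₚ B top
  chow-upper-identity-top = +ₚ-cong (≋-reflexive (chow-refl top∈)) (≋-trans (∑-zero elems vanish) (≋-sym (∑-zero elems vanish)))
    where
    vanish : ∀ {z} {p : Poly} → z ∈ elems → ⟦ top <ᵇ z ⟧ *ₚ p ≋ []
    vanish z∈ rewrite top-maximal z∈ = ≋-refl

  chow-upper-identity-step : ∀ {x} → x ∈ elems → x ≢ top →
    (∀ {w} → w ∈ elems → x < w → H w +ₚ K w ≋ oneₚ +ₚ B w) → H x +ₚ K x ≋ oneₚ +ₚ B x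
  chow-upper-identity-step {x} x∈ x≢top IH = begin
    H x +ₚ K x
      ≈⟨ +ₚ-cong (≋-trans (chow-expansion x∈ x≢top) (∑-≤ᵇ-splitˡ x∈ (λ w → μ x w *ₚ B w))) ≋-refl ⟩
    (μ x x *ₚ B x +ₚ A) +ₚ K x
      ≈⟨ +ₚ-cong (+ₚ-cong (≋-trans (*ₚ-cong (≋-reflexive (cong constₚ (mobius-refl x∈))) ≋-refl) (*ₚ-identityˡ (B x))) A≋)
                 ≋-refl ⟩
    (B x +ₚ (negₚ (K x) +ₚ negₚ (negₚ oneₚ))) +ₚ K x
      ≈⟨ solve 2 (λ b k → (b :+ (:- k :+ :- (:- con 1ℤ))) :+ k := con 1ℤ :+ b) ≋-refl (B x) (K x) ⟩
    oneₚ +ₚ B x ∎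
    where
    A : Poly
    A = ∑[ w ∈ elems ] ⟦ x <ᵇ w ⟧ *ₚ (μ x w *ₚ B w)
    U : Carrier → Poly
    U w = ∑[ z ∈ elems ] ⟦ w ≤ᵇ z ⟧ *ₚ H z

    B≋U-1 : ∀ {w} → w ∈ elems → x < w → B w ≋ U w +ₚ negₚ oneₚ
    B≋U-1 {w} w∈ x<w = begin
      B w                              ≈⟨ solve 1 (λ b → b := (con 1ℤ :+ b) :- con 1ℤ) ≋-refl (B w) ⟩
      (oneₚ +ₚ B w) +ₚ negₚ oneₚ       ≈⟨ +ₚ-cong (IH w∈ x<w) ≋-refl ⟨
      (H w +ₚ K w) +ₚ negₚ oneₚ        ≈⟨ +ₚ-cong (∑-≤ᵇ-splitˡ w∈ H) ≋-refl ⟨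
      U w +ₚ negₚ oneₚ                 ∎

    summand : ∀ {w} → w ∈ elems → ⟦ x <ᵇ w ⟧ *ₚ (μ x w *ₚ B w) ≋
              ⟦ x <ᵇ w ⟧ *ₚ (μ x w *ₚ U w) +ₚ negₚ (⟦ x <ᵇ w ⟧ *ₚ (⟦ w ≤ᵇ top ⟧ *ₚ μ x w))
    summand {w} w∈ with x <ᵇ w in x<w
    ... | false = ≋-refl
    ... | true rewrite ≤ᵇ-true (≤top w∈) = begin
      oneₚ *ₚ (μ x w *ₚ B w)
        ≈⟨ *ₚ-congʳ oneₚ (*ₚ-congʳ (μ x w) (B≋U-1 w∈ (<ᵇ-sound x<w))) ⟩
      oneₚ *ₚ (μ x w *ₚ (U w +ₚ negₚ oneₚ))
        ≈⟨ solve 2 (λ m u → con 1ℤ :* (m :* (u :- con 1ℤ)) := con 1ℤ :* (m :* u) :- con 1ℤ :* (con 1ℤ :* m))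
                   ≋-refl (μ x w) (U w) ⟩
      oneₚ *ₚ (μ x w *ₚ U w) +ₚ negₚ (oneₚ *ₚ (oneₚ *ₚ μ x w)) ∎

    A≋ : A ≋ negₚ (K x) +ₚ negₚ (negₚ oneₚ)
    A≋ = begin
      A ≈⟨ ∑-cong elems summand ⟩
      ∑[ w ∈ elems ] (⟦ x <ᵇ w ⟧ *ₚ (μ x w *ₚ U w) +ₚ negₚ (⟦ x <ᵇ w ⟧ *ₚ (⟦ w ≤ᵇ top ⟧ *ₚ μ x w)))
        ≈⟨ ∑-+ elems _ _ ⟩
      (∑[ w ∈ elems ] ⟦ x <ᵇ w ⟧ *ₚ (μ x w *ₚ U w)) +ₚ
      (∑[ w ∈ elems ] negₚ (⟦ x <ᵇ w ⟧ *ₚ (⟦ w ≤ᵇ top ⟧ *ₚ μ x w)))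
        ≈⟨ +ₚ-cong (mobius-convolution x∈) (≋-trans (∑-negₚ elems _) (scaleₚ-cong -1ℤ (mobius-∑ x∈ top∈))) ⟩
      negₚ (K x) +ₚ negₚ (negₚ ⟦ x <ᵇ top ⟧)
        ≡⟨ cong (λ b → negₚ (K x) +ₚ negₚ (negₚ ⟦ b ⟧)) (<ᵇ-true (≤top x∈ , x≢top)) ⟩
      negₚ (K x) +ₚ negₚ (negₚ oneₚ) ∎

  chow-upper-identity : ∀ {x} → x ∈ elems → H x +ₚ K x ≋ oneₚ +ₚ B x
  chow-upper-identity {x} x∈ = go (suc ∣⟨ x , top ]∣) x∈ ℕP.≤-refl
    where
    go : ∀ n {x} → x ∈ elems → ∣⟨ x , top ]∣ ℕ.< n → H x +ₚ K x ≋ oneₚ +ₚ B x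
    go (suc n) {x} x∈ (s≤s bound) with x ≟ top
    ... | yes refl = chow-upper-identity-top
    ... | no x≢top = chow-upper-identity-step x∈ x≢top λ w∈ x<w →
                       go n w∈ (ℕP.<-≤-trans (∣⟨,]∣-shrink w∈ x<w (≤top w∈)) bound)

chow≋1+t*weightedChowSum : ∀ {Q} → IsBoundedRanked Q → chow Q ≋ oneₚ +ₚ tₚ *ₚ weightedChowSum Q
chow≋1+t*weightedChowSum {Q} R = begin
  chow Q                                  ≈⟨ solve 2 (λ h s → h := (h :+ s) :- s) ≋-refl (chow Q) S₁ ⟩
  (chow Q +ₚ S₁) +ₚ negₚ S₁              ≈⟨ +ₚ-cong (+ₚ-cong (≋-refl {chow Q}) K-bot) (≋-refl {negₚ S₁}) ⟨
  (H bot +ₚ K bot) +ₚ negₚ S₁            ≈⟨ +ₚ-cong (≋-trans (chow-upper-identity bot∈) (+ₚ-cong ≋-refl B-bot)) ≋-refl ⟩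
  (oneₚ +ₚ (S₁ +ₚ tₚ *ₚ W)) +ₚ negₚ S₁  ≈⟨ solve 3 (λ s t w → (con 1ℤ :+ (s :+ t :* w)) :- s := con 1ℤ :+ t :* w)
                                                    ≋-refl S₁ tₚ W ⟩
  oneₚ +ₚ tₚ *ₚ W                         ∎
  where
  open PosetData Q
  open IsBoundedRanked R
  open BoundedRanked R
  open UpperSums R
  S₁ W : Poly
  S₁ = chowSumFromRank 1 Q
  W  = weightedChowSum Q

  K-bot : K bot ≋ S₁
  K-bot = ∑-cong elems (λ z∈ → *ₚ-cong (≋-reflexive (cong ⟦_⟧ (<ᵇ-bot z∈))) ≋-refl)

  B-bot : B bot ≋ S₁ +ₚ tₚ *ₚ W
  B-bot = begin
    B bot
      ≈⟨ ∑-cong elems (λ {z} z∈ → *ₚ-cong (≋-reflexive (cong ⟦_⟧ (<ᵇ-bot z∈)))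
                                          (≋-reflexive (cong (λ r → [ rank z ∸ r ]ₜ *ₚ H z) rank-bot))) ⟩
    ∑[ z ∈ elems ] ⟦ 1 ℕ.≤ᵇ rank z ⟧ *ₚ ([ rank z ]ₜ *ₚ H z)
      ≈⟨ ∑-cong elems (λ {z} _ → []ₜ-peel 0 (rank z) (H z)) ⟩
    ∑[ z ∈ elems ] (⟦ 1 ℕ.≤ᵇ rank z ⟧ *ₚ H z +ₚ tₚ *ₚ (⟦ 2 ℕ.≤ᵇ rank z ⟧ *ₚ ([ rank z ∸ 1 ]ₜ *ₚ H z)))
      ≈⟨ ∑-+ elems _ _ ⟩
    S₁ +ₚ (∑[ z ∈ elems ] tₚ *ₚ (⟦ 2 ℕ.≤ᵇ rank z ⟧ *ₚ ([ rank z ∸ 1 ]ₜ *ₚ H z)))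
      ≈⟨ +ₚ-cong ≋-refl (*-∑ tₚ elems _) ⟨
    S₁ +ₚ tₚ *ₚ W ∎

-- Dual truncation

∸1-mono-< : ∀ {a b} → a ≢ 1 → b ≢ 1 → a ℕ.< b → a ∸ 1 ℕ.< b ∸ 1
∸1-mono-< {zero}        {suc zero}    _   b≢1 _         = contradiction refl b≢1
∸1-mono-< {zero}        {suc (suc b)} _   _   _         = s≤s z≤n
∸1-mono-< {suc zero}    {_}           a≢1 _   _         = contradiction refl a≢1
∸1-mono-< {suc (suc a)} {suc b}       _   _   (s≤s a<b) = a<b

2≤⇒≢1 : ∀ {r} → 2 ℕ.≤ r → r ≢ 1
2≤⇒≢1 (s≤s ()) refl

≤ᵇ-∸1 : ∀ m r → (suc m ℕ.≤ᵇ r ∸ 1) ≡ (suc (suc m) ℕ.≤ᵇ r)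
≤ᵇ-∸1 m zero    = refl
≤ᵇ-∸1 m (suc r) = refl

module DualTruncation {Q : PosetData} (R : IsBoundedRanked Q) where
  open PosetData Q
  open IsBoundedRanked R
  open BoundedRanked R

  nonAtom : Carrier → Bool
  nonAtom x = not (does (rank x ℕ.≟ 1))

  nonAtom-true : ∀ {x} → rank x ≢ 1 → nonAtom x ≡ true
  nonAtom-true {x} r≢1 = cong not (dec-false (rank x ℕ.≟ 1) r≢1)

  nonAtom-sound : ∀ {x} → nonAtom x ≡ true → rank x ≢ 1
  nonAtom-sound {x} e r≡1 = contradiction (trans (sym e) (cong not (dec-true (rank x ℕ.≟ 1) r≡1))) λ ()

  ∈σ⁺ : ∀ {x} → x ∈ elems → rank x ≢ 1 → x ∈ PosetData.elems (σ Q)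
  ∈σ⁺ x∈ r≢1 = ∈-filterᵇ⁺ nonAtom elems x∈ (nonAtom-true r≢1)

  ∈σ⁻ : ∀ {x} → x ∈ PosetData.elems (σ Q) → x ∈ elems × rank x ≢ 1
  ∈σ⁻ x∈ = let (x∈E , e) = ∈-filterᵇ⁻ nonAtom elems x∈ in x∈E , nonAtom-sound e

  rank-bot≢1 : rank bot ≢ 1
  rank-bot≢1 r≡1 = contradiction (trans (sym rank-bot) r≡1) λ ()

  σ-top : rank top ≢ 1 → PosetData.top (σ Q) ≡ top
  σ-top r≢1 = cong (λ b → if b then bot else top) (dec-false (rank top ℕ.≟ 1) r≢1)

  σ-top-atom : rank top ≡ 1 → PosetData.top (σ Q) ≡ bot
  σ-top-atom r≡1 = cong (λ b → if b then bot else top) (dec-true (rank top ℕ.≟ 1) r≡1)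

  σ-elem≡bot : ∀ {x} → x ∈ PosetData.elems (σ Q) → rank top ≡ 1 → x ≡ bot
  σ-elem≡bot {x} x∈ r≡1 =
    rank≡0⇒bot x∈E (ℕP.n≤0⇒n≡0 (ℕP.≤-pred (ℕP.≤∧≢⇒< rank≤1 x≢1)))
    where
    x∈E : x ∈ elems
    x∈E = proj₁ (∈σ⁻ x∈)
    x≢1 : rank x ≢ 1
    x≢1 = proj₂ (∈σ⁻ x∈)
    rank≤1 : rank x ℕ.≤ 1
    rank≤1 = subst (rank x ℕ.≤_) r≡1 (rank-≤ x∈E top∈ (≤top x∈E))

  ≤-σ-top : ∀ {x} → x ∈ PosetData.elems (σ Q) → x ≤ PosetData.top (σ Q)
  ≤-σ-top {x} x∈ = case rank top ℕ.≟ 1 of λ where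
    (yes r≡1) → subst (x ≤_) (sym (σ-top-atom r≡1)) (subst (x ≤_) (σ-elem≡bot x∈ r≡1) (refl≤ x))
    (no r≢1)  → subst (x ≤_) (sym (σ-top r≢1)) (≤top (proj₁ (∈σ⁻ x∈)))

  σ-top∈ : PosetData.top (σ Q) ∈ PosetData.elems (σ Q)
  σ-top∈ = case rank top ℕ.≟ 1 of λ where
    (yes r≡1) → subst (_∈ PosetData.elems (σ Q)) (sym (σ-top-atom r≡1)) (∈σ⁺ bot∈ rank-bot≢1)
    (no r≢1)  → subst (_∈ PosetData.elems (σ Q)) (sym (σ-top r≢1)) (∈σ⁺ top∈ r≢1)

  σ-ranked : IsBoundedRanked (σ Q)
  σ-ranked = record
    { unique    = Unique.filter⁺ (T? ∘ nonAtom) unique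
    ; bot∈      = ∈σ⁺ bot∈ rank-bot≢1
    ; top∈      = σ-top∈
    ; refl≤     = refl≤
    ; antisym   = antisym
    ; trans≤    = trans≤
    ; bot≤      = bot≤ ∘ proj₁ ∘ ∈σ⁻
    ; ≤top      = ≤-σ-top
    ; rank-bot  = cong (_∸ 1) rank-bot
    ; rank-mono = λ x∈ y∈ x<y → let (x∈E , x≢1) = ∈σ⁻ x∈ ; (y∈E , y≢1) = ∈σ⁻ y∈ in
                                ∸1-mono-< x≢1 y≢1 (rank-mono x∈E y∈E x<y)
    }

  private module σQ = BoundedRanked σ-ranked

  -- Above rank 2 nothing is removed, so σ Q and Q have the same intervals there.
  filterᵇ-σ : ∀ {x} → x ∈ elems → 2 ℕ.≤ rank x → (p : Carrier → Bool) →
              (∀ {w} → w ∈ elems → p w ≡ true → x ≤ w) → filterᵇ p (PosetData.elems (σ Q)) ≡ filterᵇ p elems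
  filterᵇ-σ x∈ 2≤x p p⇒x≤ = filterᵇ-absorb p nonAtom elems λ w∈ pw →
    nonAtom-true (2≤⇒≢1 (ℕP.≤-trans 2≤x (rank-≤ x∈ w∈ (p⇒x≤ w∈ pw))))

  2≤-up : ∀ {x w} → x ∈ elems → 2 ℕ.≤ rank x → w ∈ elems → x ≤ w → 2 ℕ.≤ rank w
  2≤-up x∈ 2≤x w∈ x≤w = ℕP.≤-trans 2≤x (rank-≤ x∈ w∈ x≤w)

  mobiusFuel-σ : ∀ n {x y} → x ∈ elems → 2 ℕ.≤ rank x → mobiusFuel (σ Q) n x y ≡ mobiusFuel Q n x y
  mobiusFuel-σ zero    x∈ 2≤x = refl
  mobiusFuel-σ (suc n) {x} {y} x∈ 2≤x =
    cong (λ s → if x ≡ᵇ y then 1ℤ else if x ≤ᵇ y then ℤ.- sumℤ s else 0ℤ)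
      (trans (cong (map (mobiusFuel (σ Q) n x)) (filterᵇ-σ x∈ 2≤x _ (λ {w} _ e → ≤ᵇ-sound (proj₁ (∧-true⁻ {x ≤ᵇ w} e)))))
             (map-cong-∈ _ (λ _ → mobiusFuel-σ n x∈ 2≤x)))

  mobius-σ : ∀ {x w} → x ∈ elems → 2 ℕ.≤ rank x → w ∈ elems → x ≤ w → mobius (σ Q) x w ≡ mobius Q x w
  mobius-σ {x} {w} x∈ 2≤x w∈ x≤w =
    trans (mobiusFuel-σ (length (PosetData.elems (σ Q))) x∈ 2≤x) (sym (mobius≡mobiusFuel _ w∈ bound))
    where
    bound : ∣[ x , w ⟩∣ ℕ.< length (PosetData.elems (σ Q))
    bound = subst (ℕ._< _) (cong length (filterᵇ-σ x∈ 2≤x _ (λ {v} _ e → ≤ᵇ-sound (proj₁ (∧-true⁻ {x ≤ᵇ v} e)))))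
                  (σQ.∣[,⟩∣<length (∈σ⁺ w∈ (2≤⇒≢1 (2≤-up x∈ 2≤x w∈ x≤w))))

  redCharPoly-σ : ∀ {x z} → x ∈ elems → 2 ℕ.≤ rank x → redCharPoly (σ Q) x z ≡ redCharPoly Q x z
  redCharPoly-σ {x} {z} x∈ 2≤x = cong (λ c → if x ≡ᵇ z then constₚ -1ℤ else divByTMinus1 c)
    (cong sumₚ (trans (cong (map _) (filterᵇ-σ x∈ 2≤x _ (λ {w} _ e → ≤ᵇ-sound (proj₁ (∧-true⁻ {x ≤ᵇ w} e)))))
                      (map-cong-∈ _ λ {w} w∈ →
                        let (w∈E , e) = ∈-filterᵇ⁻ _ elems w∈
                            x≤w       = ≤ᵇ-sound (proj₁ (∧-true⁻ {x ≤ᵇ w} e))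
                        in cong₂ monomial (mobius-σ x∈ 2≤x w∈E x≤w)
                                          (∸-pred (ℕP.≤-trans (s≤s z≤n) (2≤-up x∈ 2≤x w∈E x≤w))))))
    where
    ∸-pred : ∀ {a b} → 1 ℕ.≤ b → (a ∸ 1) ∸ (b ∸ 1) ≡ a ∸ b
    ∸-pred {a} {suc b} _ = ℕP.∸-+-assoc a 1 b

  chowFuel-σ : ∀ n {x y} → x ∈ elems → 2 ℕ.≤ rank x → chowFuel (σ Q) n x y ≡ chowFuel Q n x y
  chowFuel-σ zero    x∈ 2≤x = refl
  chowFuel-σ (suc n) {x} {y} x∈ 2≤x =
    cong (λ s → if x ≡ᵇ y then oneₚ else sumₚ s)
      (trans (cong (map _) (filterᵇ-σ x∈ 2≤x _ (λ {z} _ e → proj₁ (<ᵇ-sound (proj₁ (∧-true⁻ {x <ᵇ z} e))))))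
             (map-cong-∈ _ λ {z} z∈ →
               let (z∈E , e) = ∈-filterᵇ⁻ _ elems z∈
                   x≤z       = proj₁ (<ᵇ-sound (proj₁ (∧-true⁻ {x <ᵇ z} e)))
               in cong₂ _*ₚ_ (redCharPoly-σ x∈ 2≤x) (chowFuel-σ n z∈E (2≤-up x∈ 2≤x z∈E x≤z))))

  chowInterval-σ : ∀ {x y} → x ∈ elems → 2 ℕ.≤ rank x → chowInterval (σ Q) x y ≡ chowInterval Q x y
  chowInterval-σ {x} {y} x∈ 2≤x =
    trans (chowFuel-σ (length (PosetData.elems (σ Q))) x∈ 2≤x) (sym (chowInterval≡chowFuel _ x∈ bound))
    where
    bound : ∣⟨ x , y ]∣ ℕ.< length (PosetData.elems (σ Q))
    bound = subst (ℕ._< _) (cong length (filterᵇ-σ x∈ 2≤x _ (λ {v} _ e → proj₁ (<ᵇ-sound (proj₁ (∧-true⁻ {x <ᵇ v} e))))))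
                  (σQ.∣⟨,]∣<length (∈σ⁺ x∈ (2≤⇒≢1 2≤x)))

  ∑-σ : ∀ m (F : ℕ → Poly → Poly) →
        ∑[ z ∈ PosetData.elems (σ Q) ] ⟦ suc m ℕ.≤ᵇ rank z ∸ 1 ⟧ *ₚ F (rank z ∸ 1) (chowInterval (σ Q) z (PosetData.top (σ Q)))
        ≋ ∑[ z ∈ elems ] ⟦ suc (suc m) ℕ.≤ᵇ rank z ⟧ *ₚ F (rank z ∸ 1) (chowInterval Q z top)
  ∑-σ m F = ≋-trans (∑-filterᵇ nonAtom elems _) (∑-cong elems summand)
    where
    kept : ∀ {z} → z ∈ elems → 2 ℕ.≤ rank z →
      ⟦ nonAtom z ⟧ *ₚ (oneₚ *ₚ F (rank z ∸ 1) (chowInterval (σ Q) z (PosetData.top (σ Q))))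
      ≋ oneₚ *ₚ F (rank z ∸ 1) (chowInterval Q z top)
    kept {z} z∈ 2≤z rewrite nonAtom-true (2≤⇒≢1 2≤z) | σ-top (2≤⇒≢1 (2≤-up z∈ 2≤z top∈ (≤top z∈)))
                          | chowInterval-σ {y = top} z∈ 2≤z = *ₚ-identityˡ _

    summand : ∀ {z} → z ∈ elems →
      ⟦ nonAtom z ⟧ *ₚ (⟦ suc m ℕ.≤ᵇ rank z ∸ 1 ⟧ *ₚ F (rank z ∸ 1) (chowInterval (σ Q) z (PosetData.top (σ Q))))
      ≋ ⟦ suc (suc m) ℕ.≤ᵇ rank z ⟧ *ₚ F (rank z ∸ 1) (chowInterval Q z top)
    summand {z} z∈ rewrite ≤ᵇ-∸1 m (rank z) with suc (suc m) ℕ.≤ᵇ rank z in above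
    ... | false = *ₚ-zeroʳ ⟦ nonAtom z ⟧
    ... | true = kept z∈ (ℕP.≤-trans (s≤s (s≤s z≤n)) (ℕ≤ᵇ-sound above))

  chowSumFromRank-σ : ∀ m → chowSumFromRank (suc m) (σ Q) ≋ chowSumFromRank (suc (suc m)) Q
  chowSumFromRank-σ m = ∑-σ m (λ _ h → h)

  weightedChowSum-σ : weightedChowSum (σ Q) ≋ ∑[ z ∈ elems ] ⟦ 3 ℕ.≤ᵇ rank z ⟧ *ₚ ([ rank z ∸ 2 ]ₜ *ₚ chowInterval Q z top)
  weightedChowSum-σ = ≋-trans (∑-σ 1 (λ r h → [ r ∸ 1 ]ₜ *ₚ h)) (∑-cong elems λ {z} _ →
    ≋-reflexive (cong (λ n → ⟦ 3 ℕ.≤ᵇ rank z ⟧ *ₚ ([ n ]ₜ *ₚ chowInterval Q z top)) (ℕP.∸-+-assoc (rank z) 1 1)))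

  chow-σ-recursion : chow Q +ₚ tₚ ≋ oneₚ +ₚ tₚ *ₚ chowSumFromRank 2 Q +ₚ tₚ *ₚ chow (σ Q)
  chow-σ-recursion = begin
    chow Q +ₚ tₚ                                   ≈⟨ +ₚ-cong (chow≋1+t*weightedChowSum R) (≋-refl {tₚ}) ⟩
    (oneₚ +ₚ tₚ *ₚ weightedChowSum Q) +ₚ tₚ
      ≈⟨ +ₚ-cong (+ₚ-cong (≋-refl {oneₚ}) (*ₚ-congʳ tₚ peel)) (≋-refl {tₚ}) ⟩
    (oneₚ +ₚ tₚ *ₚ (S₂ +ₚ tₚ *ₚ W₃)) +ₚ tₚ        ≈⟨ solve 3 (λ t s w → (con 1ℤ :+ t :* (s :+ t :* w)) :+ t
                                                               := con 1ℤ :+ t :* s :+ t :* (con 1ℤ :+ t :* w)) ≋-refl tₚ S₂ W₃ ⟩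
    oneₚ +ₚ tₚ *ₚ S₂ +ₚ tₚ *ₚ (oneₚ +ₚ tₚ *ₚ W₃)
      ≈⟨ +ₚ-cong (≋-refl {oneₚ +ₚ tₚ *ₚ S₂}) (*ₚ-congʳ tₚ σ-side) ⟨
    oneₚ +ₚ tₚ *ₚ S₂ +ₚ tₚ *ₚ chow (σ Q)          ∎
    where
    S₂ W₃ : Poly
    S₂ = chowSumFromRank 2 Q
    W₃ = ∑[ z ∈ elems ] ⟦ 3 ℕ.≤ᵇ rank z ⟧ *ₚ ([ rank z ∸ 2 ]ₜ *ₚ chowInterval Q z top)

    peel : weightedChowSum Q ≋ S₂ +ₚ tₚ *ₚ W₃
    peel = ≋-trans (∑-cong elems (λ {z} _ → []ₜ-peel 1 (rank z) (chowInterval Q z top)))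
                   (≋-trans (∑-+ elems _ _) (+ₚ-cong ≋-refl (≋-sym (*-∑ tₚ elems _))))

    σ-side : chow (σ Q) ≋ oneₚ +ₚ tₚ *ₚ W₃
    σ-side = ≋-trans (chow≋1+t*weightedChowSum σ-ranked) (+ₚ-cong (≋-refl {oneₚ}) (*ₚ-congʳ tₚ weightedChowSum-σ))

module BoundedGraded {P : PosetData} (G : IsBoundedGraded P) where
  open PosetData P
  open IsBoundedGraded G using (complete; unique; refl≤; antisym; trans≤; bot≤; ≤top; rank-bot; rank-cov)
  open PartialOrder P refl≤ antisym trans≤

  rank-mono : ∀ {x y} → x < y → rank x ℕ.< rank y
  rank-mono {x} {y} = go (suc ∣⟨ x , y ]∣) ℕP.≤-refl
    where
    go : ∀ n {x y} → ∣⟨ x , y ]∣ ℕ.< n → x < y → rank x ℕ.< rank y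
    go (suc n) {x} {y} (s≤s bound) x<y with filterᵇ (λ w → (x <ᵇ w) ∧ (w <ᵇ y)) elems in between
    ... | []    = ℕP.≤-reflexive (sym (rank-cov (x<y , nothing-between)))
      where
      nothing-between : ∀ z → ¬ (x < z × z < y)
      nothing-between z (x<z , z<y) with () ← subst (z ∈_) between
        (∈-filterᵇ⁺ _ elems (complete z) (cong₂ _∧_ (<ᵇ-true x<z) (<ᵇ-true z<y)))
    ... | z ∷ _ = ℕP.<-trans (go n (ℕP.<-≤-trans (∣⟨,]∣-shrinkʳ (complete y) x<z z<y) bound) x<z)
                             (go n (ℕP.<-≤-trans (∣⟨,]∣-shrink (complete z) x<z (proj₁ z<y)) bound) z<y)
      where
      between-z : (x <ᵇ z) ∧ (z <ᵇ y) ≡ true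
      between-z = proj₂ (∈-filterᵇ⁻ _ elems (subst (z ∈_) (sym between) (here refl)))
      x<z : x < z
      x<z = <ᵇ-sound (proj₁ (∧-true⁻ {x <ᵇ z} between-z))
      z<y : z < y
      z<y = <ᵇ-sound (proj₂ (∧-true⁻ {x <ᵇ z} between-z))

  isBoundedRanked : IsBoundedRanked P
  isBoundedRanked = record
    { unique    = unique
    ; bot∈      = complete bot
    ; top∈      = complete top
    ; refl≤     = refl≤
    ; antisym   = antisym
    ; trans≤    = trans≤
    ; bot≤      = λ {x} _ → bot≤ x
    ; ≤top      = λ {x} _ → ≤top x
    ; rank-bot  = rank-bot
    ; rank-mono = λ _ _ → rank-mono
    }

chowSumFromRank-2-split : ∀ Q → chowSumFromRank 2 Q ≋ sumRank2 Q +ₚ chowSumFromRank 3 Q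
chowSumFromRank-2-split Q = begin
  chowSumFromRank 2 Q
    ≈⟨ ∑-cong elems (λ {z} _ → split (rank z) (chowInterval Q z top)) ⟩
  ∑[ z ∈ elems ] (⟦ does (rank z ℕ.≟ 2) ⟧ *ₚ chowInterval Q z top +ₚ ⟦ 3 ℕ.≤ᵇ rank z ⟧ *ₚ chowInterval Q z top)
    ≈⟨ ∑-+ elems _ _ ⟩
  (∑[ z ∈ elems ] ⟦ does (rank z ℕ.≟ 2) ⟧ *ₚ chowInterval Q z top) +ₚ chowSumFromRank 3 Q
    ≈⟨ +ₚ-cong (∑-filterᵇ _ elems _) ≋-refl ⟨
  sumRank2 Q +ₚ chowSumFromRank 3 Q ∎
  where
  open PosetData Q
  split : ∀ r h → ⟦ 2 ℕ.≤ᵇ r ⟧ *ₚ h ≋ ⟦ does (r ℕ.≟ 2) ⟧ *ₚ h +ₚ ⟦ 3 ℕ.≤ᵇ r ⟧ *ₚ h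
  split zero                h = ≋-refl
  split (suc zero)          h = ≋-refl
  split (suc (suc zero))    h = ≋-sym (+ₚ-identityʳ _)
  split (suc (suc (suc r))) h = ≋-refl

module ChowRecursions {Q : PosetData} (R : IsBoundedRanked Q) where
  open PosetData Q
  open IsBoundedRanked R
  open BoundedRanked R
  open DualTruncation R

  chowSumFromRank-2-split-top : 2 ℕ.≤ rank top → chowSumFromRank 2 Q ≋ sumMid Q +ₚ oneₚ
  chowSumFromRank-2-split-top 2≤top = begin
    chowSumFromRank 2 Q
      ≈⟨ ∑-cong elems (λ {z} z∈ →
           *ₚ-cong (≋-trans (≋-reflexive (cong ⟦_⟧ (split z∈))) (⟦∨⟧ (mid z) (top ≡ᵇ z) (disjoint z))) ≋-refl) ⟩
    ∑[ z ∈ elems ] (⟦ mid z ⟧ +ₚ ⟦ top ≡ᵇ z ⟧) *ₚ H z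
      ≈⟨ ∑-cong elems (λ {z} _ → *ₚ-distribʳ (H z) ⟦ mid z ⟧ ⟦ top ≡ᵇ z ⟧) ⟩
    ∑[ z ∈ elems ] (⟦ mid z ⟧ *ₚ H z +ₚ ⟦ top ≡ᵇ z ⟧ *ₚ H z)
      ≈⟨ ∑-+ elems _ _ ⟩
    (∑[ z ∈ elems ] ⟦ mid z ⟧ *ₚ H z) +ₚ (∑[ z ∈ elems ] ⟦ top ≡ᵇ z ⟧ *ₚ H z)
      ≈⟨ +ₚ-cong (≋-sym (∑-filterᵇ mid elems H)) (≋-trans (∑-δ _≟_ H unique top∈) (≋-reflexive (chow-refl top∈))) ⟩
    sumMid Q +ₚ oneₚ ∎
    where
    H : Carrier → Poly
    H z = chowInterval Q z top
    mid : Carrier → Bool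
    mid z = (2 ℕ.≤ᵇ rank z) ∧ (rank z ℕ.≤ᵇ rank top ∸ 1)

    split : ∀ {z} → z ∈ elems → (2 ℕ.≤ᵇ rank z) ≡ mid z ∨ (top ≡ᵇ z)
    split {z} z∈ with top ≟ z
    ... | yes refl = trans (ℕ≤ᵇ-true 2≤top) (sym (∨-zeroʳ _))
    ... | no top≢z = sym (trans (∨-identityʳ _) (trans (cong ((2 ℕ.≤ᵇ rank z) ∧_) below-top) (∧-identityʳ _)))
      where
      below-top : (rank z ℕ.≤ᵇ rank top ∸ 1) ≡ true
      below-top = ℕ≤ᵇ-true (ℕP.∸-monoˡ-≤ 1 (rank<top z∈ (top≢z ∘ sym)))

    disjoint : ∀ z → mid z ∧ (top ≡ᵇ z) ≡ false
    disjoint z with top ≟ z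
    ... | yes refl = trans (∧-identityʳ _) (trans (cong ((2 ℕ.≤ᵇ rank top) ∧_) (ℕ≤ᵇ-false top-not-below)) (∧-zeroʳ _))
      where
      top-not-below : ¬ rank top ℕ.≤ rank top ∸ 1
      top-not-below = ℕP.<⇒≱ (ℕP.∸-monoʳ-< {o = 0} (s≤s z≤n) (ℕP.≤-trans (s≤s z≤n) 2≤top))
    ... | no _     = ∧-zeroʳ _

  chow-σ-recursion-mid : 2 ℕ.≤ rank top → chow Q ≋ oneₚ +ₚ tₚ *ₚ sumMid Q +ₚ tₚ *ₚ chow (σ Q)
  chow-σ-recursion-mid 2≤top = begin
    chow Q
      ≈⟨ solve 2 (λ h t → h := (h :+ t) :- t) ≋-refl (chow Q) tₚ ⟩
    (chow Q +ₚ tₚ) +ₚ negₚ tₚ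
      ≈⟨ +ₚ-cong chow-σ-recursion ≋-refl ⟩
    (oneₚ +ₚ tₚ *ₚ chowSumFromRank 2 Q +ₚ tₚ *ₚ chow (σ Q)) +ₚ negₚ tₚ
      ≈⟨ +ₚ-cong (+ₚ-cong (+ₚ-cong (≋-refl {oneₚ}) (*ₚ-congʳ tₚ (chowSumFromRank-2-split-top 2≤top))) ≋-refl) ≋-refl ⟩
    (oneₚ +ₚ tₚ *ₚ (sumMid Q +ₚ oneₚ) +ₚ tₚ *ₚ chow (σ Q)) +ₚ negₚ tₚ
      ≈⟨ solve 3 (λ t m h → (con 1ℤ :+ t :* (m :+ con 1ℤ) :+ t :* h) :- t := con 1ℤ :+ t :* m :+ t :* h)
                 ≋-refl tₚ (sumMid Q) (chow (σ Q)) ⟩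
    oneₚ +ₚ tₚ *ₚ sumMid Q +ₚ tₚ *ₚ chow (σ Q) ∎

  chow-σ²-recursion : chow Q ≋ (tₚ +ₚ oneₚ) *ₚ chow (σ Q) +ₚ negₚ (tₚ *ₚ chow (σ (σ Q))) +ₚ tₚ *ₚ sumRank2 Q
  chow-σ²-recursion = begin
    h₀
      ≈⟨ solve 2 (λ h t → h := (h :+ t) :- t) ≋-refl h₀ tₚ ⟩
    (h₀ +ₚ tₚ) +ₚ negₚ tₚ
      ≈⟨ +ₚ-cong (≋-trans chow-σ-recursion
                   (+ₚ-cong (+ₚ-cong (≋-refl {oneₚ}) (*ₚ-congʳ tₚ (chowSumFromRank-2-split Q))) ≋-refl)) ≋-refl ⟩
    (oneₚ +ₚ tₚ *ₚ (R₂ +ₚ S₃) +ₚ tₚ *ₚ h₁) +ₚ negₚ tₚ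
      ≈⟨ solve 5 (λ t r s h₁ h₂ → (con 1ℤ :+ t :* (r :+ s) :+ t :* h₁) :- t
                                := ((t :+ con 1ℤ) :* h₁ :- t :* h₂ :+ t :* r) :+ ((con 1ℤ :+ t :* s :+ t :* h₂) :- (h₁ :+ t)))
                 ≋-refl tₚ R₂ S₃ h₁ h₂ ⟩
    ((tₚ +ₚ oneₚ) *ₚ h₁ +ₚ negₚ (tₚ *ₚ h₂) +ₚ tₚ *ₚ R₂) +ₚ
    ((oneₚ +ₚ tₚ *ₚ S₃ +ₚ tₚ *ₚ h₂) +ₚ negₚ (h₁ +ₚ tₚ))
      ≈⟨ +ₚ-cong ≋-refl (≋-trans (+ₚ-cong σ-side ≋-refl) (-‿inverseʳ (h₁ +ₚ tₚ))) ⟩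
    ((tₚ +ₚ oneₚ) *ₚ h₁ +ₚ negₚ (tₚ *ₚ h₂) +ₚ tₚ *ₚ R₂) +ₚ []
      ≈⟨ +ₚ-identityʳ _ ⟩
    (tₚ +ₚ oneₚ) *ₚ h₁ +ₚ negₚ (tₚ *ₚ h₂) +ₚ tₚ *ₚ R₂ ∎
    where
    h₀ h₁ h₂ R₂ S₃ : Poly
    h₀ = chow Q
    h₁ = chow (σ Q)
    h₂ = chow (σ (σ Q))
    R₂ = sumRank2 Q
    S₃ = chowSumFromRank 3 Q

    σ-side : oneₚ +ₚ tₚ *ₚ S₃ +ₚ tₚ *ₚ h₂ ≋ h₁ +ₚ tₚ
    σ-side = ≋-sym (≋-trans (DualTruncation.chow-σ-recursion σ-ranked)
                            (+ₚ-cong (+ₚ-cong (≋-refl {oneₚ}) (*ₚ-congʳ tₚ (chowSumFromRank-σ 1))) ≋-refl))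

open import Data.Nat using (_≤_)

theorem4p1 : (P : PosetData) → IsBoundedGraded P →
    (2 ≤ rankP P →
      chow P ≈ₚ oneₚ +ₚ tₚ *ₚ sumMid P +ₚ tₚ *ₚ chow (σ P))
    × (chow P ≈ₚ (tₚ +ₚ oneₚ) *ₚ chow (σ P) +ₚ negₚ (tₚ *ₚ chow (σ (σ P))) +ₚ tₚ *ₚ sumRank2 P)
theorem4p1 P G = (λ 2≤rank → coeff-≡ (chow-σ-recursion-mid 2≤rank)) , coeff-≡ chow-σ²-recursion
  where open ChowRecursions (BoundedGraded.isBoundedRanked G)
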